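{- Let $\{P_1,\ldots,P_m\}\subset\mathbb{Z}[y_1,\ldots,y_n]$ be an independent family. There exist $C',\beta>0$ such that for any finite commutative ring $R$ with characteristic $N$ satisfying $\mathrm{lpf}(N)>C'$ and any subsets $A_0,\ldots,A_m\subset R$, the number of $(x,y)\in R\times R^n$ such that $(x,x+P_1(y),\ldots,x+P_m(y))\in A_0\times\cdots\times A_m$ and the set $\{0,P_1(y),\ldots,P_m(y)\}\subset R$ has fewer than $m+1$ elements is at most $|R|^{n+1}\cdot\mathrm{lpf}(N)^{ -\beta}$.
   Context: Rings are commutative with unity $1\neq0$; characteristic is the least positive $N$ with $N\cdot1_R=0$; integer polynomials are evaluated in $R$ via multiples of $1_R$. $\mathrm{lpf}(N)$ is the least prime factor of $N$. A family is independent if the only integer linear combination of its members that is constant is the trivial one. -}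

module Defs where

open import Data.Nat as ℕ using (ℕ; zero; suc; _<_; _≤_; _<ᵇ_)
open import Data.Nat.Divisibility using (_∣_)
open import Data.Nat.Primality using (Prime)
open import Data.Integer as ℤ using (ℤ; +_; -[1+_])
open import Data.Fin using (Fin)
import Data.Fin.Properties as FinP
open import Data.Fin.Subset using (Subset)
open import Data.Fin.Subset.Properties using (_∈?_)
open import Data.Vec as Vec using (Vec; []; _∷_)
open import Data.Vec.Properties using (≡-dec)
open import Data.List as List using (List; []; _∷_; [_]; length; map; concatMap; allFin; foldr; deduplicate)
open import Data.Product using (_×_; _,_)
open import Data.Bool using (Bool; true; false; _∧_; if_then_else_)
open import Algebra.Core using (Op₁; Op₂)
open import Algebra.Structures using (IsCommutativeRing)
open import Relation.Nullary using (¬_; does)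
open import Relation.Binary.PropositionalEquality using (_≡_; _≢_)

-- Integer polynomials in n variables: finite lists of terms (exponent vector, coefficient).
-- The polynomial represented is the sum of its terms (repeated monomials add up).
Poly : ℕ → Set
Poly n = List (Vec ℕ n × ℤ)

coeff : ∀ {n} → Poly n → Vec ℕ n → ℤ
coeff [] α = + 0
coeff ((β , c) ∷ P) α =
  (if does (≡-dec ℕ._≟_ β α) then c else + 0) ℤ.+ coeff P α

sumℤ : ∀ {m} → (Fin m → ℤ) → ℤ
sumℤ {m} f = foldr ℤ._+_ (+ 0) (map f (allFin m))

-- Independence: the only integer linear combination Σ cᵢ Pᵢ that is a constant
-- polynomial (all non-constant coefficients vanish) is the trivial one.
Independent : ∀ {n m} → (Fin m → Poly n) → Set
Independent {n} {m} P =
  (c : Fin m → ℤ) →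
  (∀ (α : Vec ℕ n) → α ≢ Vec.replicate n 0 → sumℤ (λ i → c i ℤ.* coeff (P i) α) ≡ + 0) →
  ∀ i → c i ≡ + 0

-- A finite commutative ring with unity 1 ≠ 0, with carrier Fin k (|R| = k).
-- Every finite commutative ring is isomorphic to one of this form.
record FinCommRing (k : ℕ) : Set where
  infixl 7 _*_
  infixl 6 _+_
  field
    _+_ _*_ : Op₂ (Fin k)
    -_ : Op₁ (Fin k)
    0# 1# : Fin k
    isCommutativeRing : IsCommutativeRing _≡_ _+_ _*_ -_ 0# 1#
    1≢0 : 1# ≢ 0#

module _ {k : ℕ} (R : FinCommRing k) where
  open FinCommRing R

  natCast : ℕ → Fin k
  natCast zero = 0#
  natCast (suc n) = 1# + natCast n

  intCast : ℤ → Fin k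
  intCast (+ n) = natCast n
  intCast -[1+ n ] = - natCast (suc n)

  pow : Fin k → ℕ → Fin k
  pow x zero = 1#
  pow x (suc e) = x * pow x e

  monomial : ∀ {n} → Vec ℕ n → Vec (Fin k) n → Fin k
  monomial [] [] = 1#
  monomial (e ∷ α) (y ∷ ys) = pow y e * monomial α ys

  eval : ∀ {n} → Poly n → Vec (Fin k) n → Fin k
  eval [] y = 0#
  eval ((α , c) ∷ P) y = intCast c * monomial α y + eval P y

  IsCharacteristic : ℕ → Set
  IsCharacteristic N =
    0 < N × natCast N ≡ 0# × (∀ M → 0 < M → M < N → natCast M ≢ 0#)

  allVecs : ∀ n → List (Vec (Fin k) n)
  allVecs zero = [ [] ]
  allVecs (suc n) = concatMap (λ v → map (_∷ v) (allFin k)) (allVecs n)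

  memb : Fin k → Subset k → Bool
  memb x A = does (x ∈? A)

  good : ∀ {n m} → (Fin m → Poly n) → (Fin (suc m) → Subset k) → Fin k → Vec (Fin k) n → Bool
  good {n} {m} P A x y =
    memb x (A Fin.zero)
    ∧ foldr _∧_ true (map (λ i → memb (x + eval (P i) y) (A (Fin.suc i))) (allFin m))
    ∧ (length (deduplicate FinP._≟_ (0# ∷ map (λ i → eval (P i) y) (allFin m))) <ᵇ suc m)
    where import Data.Fin as Fin

  count : ∀ {n m} → (Fin m → Poly n) → (Fin (suc m) → Subset k) → ℕ
  count {n} P A =
    foldr ℕ._+_ 0
      (concatMap (λ x → map (λ y → if good P A x y then 1 else 0) (allVecs n)) (allFin k))

IsLpf : ℕ → ℕ → Set
IsLpf p N = Prime p × p ∣ N × (∀ q → Prime q → q ∣ N → p ≤ q)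

{-# OPTIONS --safe #-}
-- Let F consist of the Pᵢ and the differences Pᵢ − Pⱼ (i ≠ j); by independence no member of F is the zero
-- polynomial. If {0, P₁(y), …, Pₘ(y)} has fewer than m + 1 elements then some Q ∈ F vanishes at y, so the
-- count is at most |R| · Σ_{Q ∈ F} #{y : Q(y) = 0}.
-- For a single Q pick W above all its exponents and restrict Q to the curves t ↦ y + (t, t^W, t^W², …).
-- Reading exponent vectors in base W, each restriction is a polynomial in t of degree d (the largest weight
-- in the support of Q) whose leading coefficient is a coefficient of Q, hence a unit once lpf(N) exceeds the
-- coefficients. The elements 0, 1, …, p − 1 of R (p = lpf(N)) have unit differences, so each curve meets
-- the zero set of Q in at most d of them, and averaging over these p translates gives
-- p · #{Q = 0} ≤ |R|ⁿ · d. Summing over F gives p · count ≤ |R|ⁿ⁺¹ · K with K the sum of these degrees,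
-- and p > K² yields count² · p ≤ |R|²⁽ⁿ⁺¹⁾, i.e. the statement with β = 1/2.
module Submission where

open import Defs
open import Level using (0ℓ)
open import Function using (_∘_; id)
open import Data.Empty using (⊥-elim)
open import Data.Bool using (true; false; if_then_else_; _∧_)
import Data.Bool.Properties as BoolP
open import Data.Product using (Σ; ∃; _×_; _,_; proj₁; proj₂)
open import Data.Sum using (inj₁; inj₂)
open import Data.Nat as ℕ using (ℕ; zero; suc; _≤_; _<_; z≤n; s≤s; _⊔_; _<ᵇ_; NonZero)
import Data.Nat.Properties as ℕP
open import Data.Nat.Divisibility using (_∣_; ∣⇒≤; ∣-trans; 0∣⇒≡0)
open import Data.Nat.Primality using (Prime)
open import Data.Nat.Primality.Factorisation using (factorise; PrimeFactorisation)
open import Data.Nat.ListAction.Properties using (∈⇒∣product)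
open import Data.Nat.Coprimality using (Coprime; coprime-Bézout)
import Data.Nat.GCD
open Data.Nat.GCD.Bézout using () renaming (module Identity to Bézout)
open import Data.Nat.DivMod using (_%_; [m+kn]%n≡m%n; m<n⇒m%n≡m)
open import Data.Nat.Tactic.RingSolver using (solve-∀)
open import Data.Integer as ℤ using (ℤ; -[1+_])
import Data.Integer.Properties as ℤP
open import Data.Integer.Tactic.RingSolver using () renaming (solve-∀ to ℤsolve-∀)
open import Data.Fin as Fin using (Fin)
import Data.Fin.Properties as FinP
open import Data.Fin.Subset using (Subset)
open import Data.Fin.Permutation using (Permutation′; permutation; _⟨$⟩ʳ_)
open import Data.Vec as Vec using (Vec; []; _∷_)
open import Data.Vec.Properties using (≡-dec)
import Data.Vec.Relation.Unary.All as VAll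
import Data.Vec.Relation.Unary.All.Properties as VAllP
open import Data.List
  using (List; []; _∷_; [_]; _++_; length; map; filter; concatMap; foldr; allFin; tabulate; applyUpTo; deduplicate)
import Data.List.Properties as ListP
import Data.List.Extrema.Nat as Extremaℕ
open import Data.List.Relation.Unary.All as All using (All; []; _∷_)
import Data.List.Relation.Unary.All.Properties as AllP
open import Data.List.Relation.Unary.Any as Any using (here; there)
open import Data.List.Relation.Unary.AllPairs using (AllPairs; []; _∷_)
import Data.List.Relation.Unary.AllPairs.Properties as AllPairsP
open import Data.List.Relation.Unary.Unique.Propositional using (Unique)
import Data.List.Relation.Unary.Unique.Propositional.Properties as UniqueP
import Data.List.Relation.Unary.Unique.DecPropositional.Properties as UniqueDecP
open import Data.List.Membership.Propositional using (_∈_; _∉_)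
import Data.List.Membership.Propositional.Properties as ∈P
import Data.List.Membership.DecPropositional as DecMembership
open import Algebra.Core using (Op₂)
open import Algebra.Structures using (IsCommutativeMonoid; IsCommutativeRing)
import Algebra.Properties.CommutativeMonoid.Sum as FinSum
import Algebra.Properties.Ring
import Algebra.Properties.AbelianGroup
import Algebra.Properties.CommutativeSemigroup
open import Algebra.Bundles using (CommutativeSemigroup; CommutativeRing)
open import Algebra.Solver.Ring.AlmostCommutativeRing using (fromCommutativeRing; _-Raw-AlmostCommutative⟶_)
import Algebra.Solver.Ring
open import Data.Integer.Base using (_◃_; sign)
open import Data.Sign as Sign using (Sign)
import Data.Maybe
open import Relation.Nullary.Decidable using (dec⇒maybe)
open import Relation.Binary.PropositionalEquality hiding ([_])
open import Relation.Nullary using (¬_; Dec; yes; no; does; ¬?)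

module ListSum {A : Set} {_∙_ : Op₂ A} {ε : A} (isCM : IsCommutativeMonoid _≡_ _∙_ ε) where
  open IsCommutativeMonoid isCM using (assoc; identityˡ; identityʳ; isCommutativeSemigroup)

  private
    commutativeSemigroup : CommutativeSemigroup 0ℓ 0ℓ
    commutativeSemigroup = record { isCommutativeSemigroup = isCommutativeSemigroup }

  open Algebra.Properties.CommutativeSemigroup commutativeSemigroup using (interchange)

  sum : ∀ {b} {B : Set b} → List B → (B → A) → A
  sum xs f = foldr _∙_ ε (map f xs)

  module _ {b} {B : Set b} where

    sum-cong : ∀ (xs : List B) {f g} → (∀ x → x ∈ xs → f x ≡ g x) → sum xs f ≡ sum xs g
    sum-cong []       f≗g = refl
    sum-cong (x ∷ xs) f≗g = cong₂ _∙_ (f≗g x (here refl)) (sum-cong xs (λ y y∈xs → f≗g y (there y∈xs)))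

    sum-zero : ∀ (xs : List B) {f} → (∀ x → x ∈ xs → f x ≡ ε) → sum xs f ≡ ε
    sum-zero []       f≗ε = refl
    sum-zero (x ∷ xs) f≗ε =
      trans (cong₂ _∙_ (f≗ε x (here refl)) (sum-zero xs (λ y y∈xs → f≗ε y (there y∈xs)))) (identityˡ ε)

    sum-single : ∀ (xs : List B) {f x} → Unique xs → x ∈ xs → (∀ y → y ∈ xs → y ≢ x → f y ≡ ε) → sum xs f ≡ f x
    sum-single (y ∷ xs) {f} (y∉xs ∷ xs!) (here refl) others =
      trans (cong (f y ∙_) (sum-zero xs (λ z z∈xs → others z (there z∈xs) (All.lookup y∉xs z∈xs ∘ sym)))) (identityʳ _)
    sum-single (y ∷ xs) (y∉xs ∷ xs!) (there x∈xs) others =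
      trans (cong₂ _∙_ (others y (here refl) (All.lookup y∉xs x∈xs)) (sum-single xs xs! x∈xs (λ z z∈xs → others z (there z∈xs))))
            (identityˡ _)

    sum-homo : ∀ (h : A → A) → h ε ≡ ε → (∀ a b → h (a ∙ b) ≡ h a ∙ h b) →
               ∀ (xs : List B) f → sum xs (h ∘ f) ≡ h (sum xs f)
    sum-homo h h-ε h-∙ []       f = sym h-ε
    sum-homo h h-ε h-∙ (x ∷ xs) f = trans (cong (h (f x) ∙_) (sum-homo h h-ε h-∙ xs f)) (sym (h-∙ (f x) _))

    sum-∙ : ∀ (xs : List B) f g → sum xs (λ x → f x ∙ g x) ≡ sum xs f ∙ sum xs g
    sum-∙ []       f g = sym (identityˡ ε)
    sum-∙ (x ∷ xs) f g = trans (cong ((f x ∙ g x) ∙_) (sum-∙ xs f g)) (interchange (f x) (g x) _ _)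

    sum-filter : ∀ {p} {P : B → Set p} (P? : ∀ x → Dec (P x)) (xs : List B) {f} →
                 (∀ x → ¬ P x → f x ≡ ε) → sum (filter P? xs) f ≡ sum xs f
    sum-filter P? []       f≗ε = refl
    sum-filter P? (x ∷ xs) {f} f≗ε with P? x
    ... | yes _  = cong (f x ∙_) (sum-filter P? xs f≗ε)
    ... | no ¬Px = trans (sum-filter P? xs f≗ε) (sym (trans (cong (_∙ sum xs f) (f≗ε x ¬Px)) (identityˡ _)))

    sum-++ : ∀ (xs ys : List B) f → sum (xs ++ ys) f ≡ sum xs f ∙ sum ys f
    sum-++ []       ys f = sym (identityˡ _)
    sum-++ (x ∷ xs) ys f = trans (cong (f x ∙_) (sum-++ xs ys f)) (sym (assoc (f x) _ _))

  sum-map : ∀ {b c} {B : Set b} {C : Set c} (g : B → C) (xs : List B) f → sum (map g xs) f ≡ sum xs (f ∘ g)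
  sum-map g xs f = cong (foldr _∙_ ε) (sym (ListP.map-∘ xs))

  sum-swap : ∀ {b c} {B : Set b} {C : Set c} (xs : List B) (ys : List C) (f : B → C → A) →
             sum xs (λ x → sum ys (f x)) ≡ sum ys (λ y → sum xs (λ x → f x y))
  sum-swap []       ys f = sym (sum-zero ys (λ _ _ → refl))
  sum-swap (x ∷ xs) ys f =
    trans (cong (sum ys (f x) ∙_) (sum-swap xs ys f)) (sym (sum-∙ ys (f x) (λ y → sum xs (λ x′ → f x′ y))))

  sum-concatMap : ∀ {b c} {B : Set b} {C : Set c} (g : B → List C) (xs : List B) f →
                  sum (concatMap g xs) f ≡ sum xs (λ x → sum (g x) f)
  sum-concatMap g []       f = refl
  sum-concatMap g (x ∷ xs) f = trans (sum-++ (g x) (concatMap g xs) f) (cong (sum (g x) f ∙_) (sum-concatMap g xs f))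

module Σℕ where
  open ListSum ℕP.+-0-isCommutativeMonoid public

  module _ {b} {B : Set b} where

    sum-const : ∀ (xs : List B) c → sum xs (λ _ → c) ≡ length xs ℕ.* c
    sum-const []       c = refl
    sum-const (x ∷ xs) c = cong (c ℕ.+_) (sum-const xs c)

    sum-*ˡ : ∀ c (xs : List B) f → sum xs (λ x → c ℕ.* f x) ≡ c ℕ.* sum xs f
    sum-*ˡ c = sum-homo (c ℕ.*_) (ℕP.*-zeroʳ c) (ℕP.*-distribˡ-+ c)

    sum-mono : ∀ (xs : List B) {f g} → (∀ x → x ∈ xs → f x ≤ g x) → sum xs f ≤ sum xs g
    sum-mono []       f≤g = z≤n
    sum-mono (x ∷ xs) f≤g = ℕP.+-mono-≤ (f≤g x (here refl)) (sum-mono xs (λ y y∈xs → f≤g y (there y∈xs)))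

    ≤-sum : ∀ (xs : List B) f {x} → x ∈ xs → f x ≤ sum xs f
    ≤-sum (y ∷ xs) f (here refl)  = ℕP.m≤m+n (f y) _
    ≤-sum (y ∷ xs) f (there x∈xs) = ℕP.≤-trans (≤-sum xs f x∈xs) (ℕP.m≤n+m _ (f y))

    sum≡0⇒ : ∀ (xs : List B) f {x} → sum xs f ≡ 0 → x ∈ xs → f x ≡ 0
    sum≡0⇒ (y ∷ xs) f Σ≡0 (here refl)  = ℕP.m+n≡0⇒m≡0 (f y) Σ≡0
    sum≡0⇒ (y ∷ xs) f Σ≡0 (there x∈xs) = sum≡0⇒ xs f (ℕP.m+n≡0⇒n≡0 (f y) Σ≡0) x∈xs

  indicator : ∀ {p} {P : Set p} → Dec P → ℕ
  indicator P? = if does P? then 1 else 0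

  sum-indicator : ∀ {b p} {B : Set b} {P : B → Set p} (P? : ∀ x → Dec (P x)) (xs : List B) →
                  sum xs (indicator ∘ P?) ≡ length (filter P? xs)
  sum-indicator P? []       = refl
  sum-indicator P? (x ∷ xs) with P? x
  ... | yes _ = cong suc (sum-indicator P? xs)
  ... | no  _ = sum-indicator P? xs

  sum-permute : ∀ {m} (π : Permutation′ m) f → sum (allFin m) (λ i → f (π ⟨$⟩ʳ i)) ≡ sum (allFin m) f
  sum-permute {m} π f = trans (tabulate-sum id (λ i → f (π ⟨$⟩ʳ i))) (trans (sym (ΣFin.sum-permute f π)) (sym (tabulate-sum id f)))
    where
    module ΣFin = FinSum ℕP.+-0-commutativeMonoid
    tabulate-sum : ∀ {m} {C : Set} (h : Fin m → C) (g : C → ℕ) → sum (tabulate h) g ≡ ΣFin.sum (g ∘ h)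
    tabulate-sum {zero}  h g = refl
    tabulate-sum {suc m} h g = cong (g (h Fin.zero) ℕ.+_) (tabulate-sum (h ∘ Fin.suc) g)

module Σℤ = ListSum ℤP.+-0-isCommutativeMonoid

module RingFacts {k : ℕ} (R : FinCommRing k) where
  open FinCommRing R public
  open IsCommutativeRing isCommutativeRing public
    using ( +-assoc; +-comm; *-assoc; +-identityˡ; +-identityʳ; *-identityˡ; *-identityʳ
          ; -‿inverseʳ; distribʳ; zeroˡ; zeroʳ; +-isCommutativeMonoid)

  commutativeRing : CommutativeRing 0ℓ 0ℓ
  commutativeRing = record { isCommutativeRing = isCommutativeRing }

  open ≡-Reasoning

  open Algebra.Properties.Ring (CommutativeRing.ring commutativeRing) public
    using (-‿distribˡ-*)
  open Algebra.Properties.AbelianGroup (CommutativeRing.+-abelianGroup commutativeRing) public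
    using () renaming (ε⁻¹≈ε to -0#≡0#; ⁻¹-involutive to -‿involutive; ⁻¹-∙-comm to -‿+-comm)
  open Algebra.Properties.CommutativeSemigroup (CommutativeRing.+-commutativeSemigroup commutativeRing)
    using () renaming (interchange to +-interchange)
  open Algebra.Properties.CommutativeSemigroup (CommutativeRing.*-commutativeSemigroup commutativeRing)
    using () renaming (interchange to *-interchange)

  infixl 6 _-_
  _-_ : Op₂ (Fin k)
  x - y = x + - y

  natCast-+ : ∀ a b → natCast R (a ℕ.+ b) ≡ natCast R a + natCast R b
  natCast-+ zero    b = sym (+-identityˡ _)
  natCast-+ (suc a) b = trans (cong (1# +_) (natCast-+ a b)) (sym (+-assoc _ _ _))

  natCast-* : ∀ a b → natCast R (a ℕ.* b) ≡ natCast R a * natCast R b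
  natCast-* zero    b = sym (zeroˡ _)
  natCast-* (suc a) b = begin
    natCast R (b ℕ.+ a ℕ.* b)                 ≡⟨ natCast-+ b (a ℕ.* b) ⟩
    natCast R b + natCast R (a ℕ.* b)         ≡⟨ cong₂ _+_ (sym (*-identityˡ _)) (natCast-* a b) ⟩
    1# * natCast R b + natCast R a * natCast R b ≡⟨ sym (distribʳ _ 1# _) ⟩
    (1# + natCast R a) * natCast R b          ∎

  intCast-⊖ : ∀ m n → intCast R (m ℤ.⊖ n) ≡ natCast R m - natCast R n
  intCast-⊖ m       zero    = begin
    intCast R (m ℤ.⊖ 0)   ≡⟨ cong (intCast R) (ℤP.⊖-≥ {m} z≤n) ⟩
    natCast R m           ≡⟨ sym (+-identityʳ _) ⟩
    natCast R m + 0#      ≡⟨ cong (natCast R m +_) (sym -0#≡0#) ⟩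
    natCast R m - 0#      ∎
  intCast-⊖ zero    (suc n) = sym (+-identityˡ _)
  intCast-⊖ (suc m) (suc n) = begin
    intCast R (suc m ℤ.⊖ suc n)     ≡⟨ cong (intCast R) (ℤP.[1+m]⊖[1+n]≡m⊖n m n) ⟩
    intCast R (m ℤ.⊖ n)             ≡⟨ intCast-⊖ m n ⟩
    a - b                           ≡⟨ sym (+-identityˡ _) ⟩
    0# + (a - b)                    ≡⟨ cong (_+ (a - b)) (sym (-‿inverseʳ 1#)) ⟩
    (1# - 1#) + (a - b)             ≡⟨ sym (+-interchange 1# a (- 1#) (- b)) ⟩
    (1# + a) + (- 1# - b)           ≡⟨ cong ((1# + a) +_) (-‿+-comm 1# b) ⟩
    (1# + a) - (1# + b)             ∎
    where a = natCast R m; b = natCast R n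

  intCast-+ : ∀ i j → intCast R (i ℤ.+ j) ≡ intCast R i + intCast R j
  intCast-+ (ℤ.+ m)  (ℤ.+ n)  = natCast-+ m n
  intCast-+ (ℤ.+ m)  -[1+ n ] = intCast-⊖ m (suc n)
  intCast-+ -[1+ m ] (ℤ.+ n)  = trans (intCast-⊖ n (suc m)) (+-comm _ _)
  intCast-+ -[1+ m ] -[1+ n ] = begin
    - natCast R (suc (suc (m ℕ.+ n)))         ≡⟨ cong (λ z → - natCast R (suc z)) (sym (ℕP.+-suc m n)) ⟩
    - natCast R (suc m ℕ.+ suc n)             ≡⟨ cong -_ (natCast-+ (suc m) (suc n)) ⟩
    - (natCast R (suc m) + natCast R (suc n)) ≡⟨ sym (-‿+-comm _ _) ⟩
    - natCast R (suc m) - natCast R (suc n)   ∎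

  intCast-neg : ∀ i → intCast R (ℤ.- i) ≡ - intCast R i
  intCast-neg (ℤ.+ zero)  = sym -0#≡0#
  intCast-neg (ℤ.+ suc n) = refl
  intCast-neg -[1+ n ]    = sym (-‿involutive _)

  signCast : Sign → Fin k
  signCast Sign.+ = 1#
  signCast Sign.- = - 1#

  signCast-* : ∀ s t → signCast (s Sign.* t) ≡ signCast s * signCast t
  signCast-* Sign.+ t      = sym (*-identityˡ _)
  signCast-* Sign.- Sign.+ = sym (*-identityʳ _)
  signCast-* Sign.- Sign.- = begin
    1#             ≡⟨ sym (-‿involutive 1#) ⟩
    - - 1#         ≡⟨ cong -_ (sym (*-identityˡ (- 1#))) ⟩
    - (1# * - 1#)  ≡⟨ -‿distribˡ-* 1# (- 1#) ⟩
    - 1# * - 1#    ∎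

  intCast-◃ : ∀ s n → intCast R (s ◃ n) ≡ signCast s * natCast R n
  intCast-◃ s      zero    = sym (zeroʳ _)
  intCast-◃ Sign.+ (suc n) = sym (*-identityˡ _)
  intCast-◃ Sign.- (suc n) = trans (cong -_ (sym (*-identityˡ _))) (-‿distribˡ-* 1# _)

  intCast-* : ∀ i j → intCast R (i ℤ.* j) ≡ intCast R i * intCast R j
  intCast-* i j = begin
    intCast R (i ℤ.* j)                                 ≡⟨ intCast-◃ (sign i Sign.* sign j) (ℤ.∣ i ∣ ℕ.* ℤ.∣ j ∣) ⟩
    signCast (sign i Sign.* sign j) * natCast R (ℤ.∣ i ∣ ℕ.* ℤ.∣ j ∣)
      ≡⟨ cong₂ _*_ (signCast-* (sign i) (sign j)) (natCast-* ℤ.∣ i ∣ ℤ.∣ j ∣) ⟩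
    (sᵢ * sⱼ) * (aᵢ * aⱼ)                               ≡⟨ *-interchange sᵢ sⱼ aᵢ aⱼ ⟩
    (sᵢ * aᵢ) * (sⱼ * aⱼ)                               ≡⟨ sym (cong₂ _*_ (sign◃abs i) (sign◃abs j)) ⟩
    intCast R i * intCast R j                           ∎
    where
    sᵢ = signCast (sign i); sⱼ = signCast (sign j); aᵢ = natCast R ℤ.∣ i ∣; aⱼ = natCast R ℤ.∣ j ∣
    sign◃abs : ∀ i → intCast R i ≡ signCast (sign i) * natCast R ℤ.∣ i ∣
    sign◃abs i = trans (cong (intCast R) (sym (ℤP.◃-inverse i))) (intCast-◃ (sign i) ℤ.∣ i ∣)

  intCast-homomorphism : CommutativeRing.rawRing ℤP.+-*-commutativeRing -Raw-AlmostCommutative⟶ fromCommutativeRing commutativeRing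
  intCast-homomorphism = record
    { ⟦_⟧    = intCast R
    ; +-homo = intCast-+
    ; *-homo = intCast-*
    ; -‿homo = intCast-neg
    ; 0-homo = refl
    ; 1-homo = +-identityʳ 1#
    }

  open Algebra.Solver.Ring (CommutativeRing.rawRing ℤP.+-*-commutativeRing) (fromCommutativeRing commutativeRing)
    intCast-homomorphism (λ a b → Data.Maybe.map (cong (intCast R)) (dec⇒maybe (a ℤ.≟ b))) public

  pow-+ : ∀ t d e → pow R t (d ℕ.+ e) ≡ pow R t d * pow R t e
  pow-+ t zero    e = sym (*-identityˡ _)
  pow-+ t (suc d) e = trans (cong (t *_) (pow-+ t d e)) (sym (*-assoc _ _ _))

  Unit : Fin k → Set
  Unit u = ∃ λ v → v * u ≡ 1#

  unit-cancel : ∀ {u x} → Unit u → u * x ≡ 0# → x ≡ 0#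
  unit-cancel {u} {x} (v , vu≡1) ux≡0 = begin
    x            ≡⟨ sym (*-identityˡ x) ⟩
    1# * x       ≡⟨ cong (_* x) (sym vu≡1) ⟩
    (v * u) * x  ≡⟨ *-assoc v u x ⟩
    v * (u * x)  ≡⟨ cong (v *_) ux≡0 ⟩
    v * 0#       ≡⟨ zeroʳ v ⟩
    0#           ∎

  unit⇒≢0 : ∀ {u} → Unit u → u ≢ 0#
  unit⇒≢0 (v , vu≡1) u≡0 = 1≢0 (trans (sym vu≡1) (trans (cong (v *_) u≡0) (zeroʳ v)))

  -‿unit : ∀ {u} → Unit u → Unit (- u)
  -‿unit {u} (v , vu≡1) = - v , trans (solve 2 (λ v u → :- v :* :- u := v :* u) refl v u) vu≡1

  Apart : Fin k → Fin k → Set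
  Apart a b = Unit (b - a)

module Univariate {k : ℕ} (R : FinCommRing k) where
  open RingFacts R
  open ≡-Reasoning

  UPoly : Set
  UPoly = List (Fin k)

  ueval : UPoly → Fin k → Fin k
  ueval []      t = 0#
  ueval (a ∷ f) t = a + t * ueval f t

  ucoeff : UPoly → ℕ → Fin k
  ucoeff []      j       = 0#
  ucoeff (a ∷ f) zero    = a
  ucoeff (a ∷ f) (suc j) = ucoeff f j

  infixl 6 _+ᵤ_
  _+ᵤ_ : UPoly → UPoly → UPoly
  []      +ᵤ g       = g
  (a ∷ f) +ᵤ []      = a ∷ f
  (a ∷ f) +ᵤ (b ∷ g) = (a + b) ∷ (f +ᵤ g)

  infixr 7 _·ᵤ_
  _·ᵤ_ : Fin k → UPoly → UPoly
  c ·ᵤ f = map (c *_) f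

  X^_·_ : ℕ → UPoly → UPoly
  X^ zero  · f = f
  X^ suc d · f = 0# ∷ X^ d · f

  infixl 7 _*ᵤ_
  _*ᵤ_ : UPoly → UPoly → UPoly
  []      *ᵤ g = []
  (a ∷ f) *ᵤ g = a ·ᵤ g +ᵤ (0# ∷ f *ᵤ g)

  X^ : ℕ → UPoly
  X^ d = X^ d · [ 1# ]

  ueval-+ᵤ : ∀ f g t → ueval (f +ᵤ g) t ≡ ueval f t + ueval g t
  ueval-+ᵤ []      g       t = sym (+-identityˡ _)
  ueval-+ᵤ (a ∷ f) []      t = sym (+-identityʳ _)
  ueval-+ᵤ (a ∷ f) (b ∷ g) t = begin
    (a + b) + t * ueval (f +ᵤ g) t             ≡⟨ cong (λ z → (a + b) + t * z) (ueval-+ᵤ f g t) ⟩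
    (a + b) + t * (ueval f t + ueval g t)      ≡⟨ solve 5 (λ a b t u v → (a :+ b) :+ t :* (u :+ v) := (a :+ t :* u) :+ (b :+ t :* v))
                                                       refl a b t (ueval f t) (ueval g t) ⟩
    (a + t * ueval f t) + (b + t * ueval g t)  ∎

  ueval-·ᵤ : ∀ c f t → ueval (c ·ᵤ f) t ≡ c * ueval f t
  ueval-·ᵤ c []      t = sym (zeroʳ c)
  ueval-·ᵤ c (a ∷ f) t = begin
    c * a + t * ueval (c ·ᵤ f) t   ≡⟨ cong (λ z → c * a + t * z) (ueval-·ᵤ c f t) ⟩
    c * a + t * (c * ueval f t)    ≡⟨ solve 4 (λ c a t u → c :* a :+ t :* (c :* u) := c :* (a :+ t :* u)) refl c a t (ueval f t) ⟩
    c * (a + t * ueval f t)        ∎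

  ueval-X^· : ∀ d f t → ueval (X^ d · f) t ≡ pow R t d * ueval f t
  ueval-X^· zero    f t = sym (*-identityˡ _)
  ueval-X^· (suc d) f t = begin
    0# + t * ueval (X^ d · f) t        ≡⟨ cong (λ z → 0# + t * z) (ueval-X^· d f t) ⟩
    0# + t * (pow R t d * ueval f t)   ≡⟨ solve 3 (λ t u v → con (ℤ.+ 0) :+ t :* (u :* v) := (t :* u) :* v) refl t (pow R t d) (ueval f t) ⟩
    (t * pow R t d) * ueval f t        ∎

  ueval-*ᵤ : ∀ f g t → ueval (f *ᵤ g) t ≡ ueval f t * ueval g t
  ueval-*ᵤ []      g t = sym (zeroˡ _)
  ueval-*ᵤ (a ∷ f) g t = begin
    ueval (a ·ᵤ g +ᵤ (0# ∷ f *ᵤ g)) t                    ≡⟨ ueval-+ᵤ (a ·ᵤ g) _ t ⟩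
    ueval (a ·ᵤ g) t + (0# + t * ueval (f *ᵤ g) t)        ≡⟨ cong₂ (λ u v → u + (0# + t * v)) (ueval-·ᵤ a g t) (ueval-*ᵤ f g t) ⟩
    a * ueval g t + (0# + t * (ueval f t * ueval g t))    ≡⟨ solve 4 (λ a t u v → a :* v :+ (con (ℤ.+ 0) :+ t :* (u :* v)) := (a :+ t :* u) :* v)
                                                                 refl a t (ueval f t) (ueval g t) ⟩
    (a + t * ueval f t) * ueval g t                      ∎

  ueval-X^ : ∀ d t → ueval (X^ d) t ≡ pow R t d
  ueval-X^ d t = begin
    ueval (X^ d) t                ≡⟨ ueval-X^· d [ 1# ] t ⟩
    pow R t d * (1# + t * 0#)     ≡⟨ cong (λ z → pow R t d * (1# + z)) (zeroʳ t) ⟩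
    pow R t d * (1# + 0#)         ≡⟨ cong (pow R t d *_) (+-identityʳ 1#) ⟩
    pow R t d * 1#                ≡⟨ *-identityʳ _ ⟩
    pow R t d                     ∎

  length-+ᵤ : ∀ f g → length (f +ᵤ g) ≡ length f ⊔ length g
  length-+ᵤ []      g       = refl
  length-+ᵤ (a ∷ f) []      = refl
  length-+ᵤ (a ∷ f) (b ∷ g) = cong suc (length-+ᵤ f g)

  length-+ᵤ-≤ : ∀ {f g n} → length f ≤ n → length g ≤ n → length (f +ᵤ g) ≤ n
  length-+ᵤ-≤ {f} {g} f≤n g≤n = subst (_≤ _) (sym (length-+ᵤ f g)) (ℕP.⊔-lub f≤n g≤n)

  length-·ᵤ : ∀ c f → length (c ·ᵤ f) ≡ length f
  length-·ᵤ c = ListP.length-map (c *_)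

  length-X^· : ∀ d f → length (X^ d · f) ≡ d ℕ.+ length f
  length-X^· zero    f = refl
  length-X^· (suc d) f = cong suc (length-X^· d f)

  length-*ᵤ : ∀ f g → length (f *ᵤ g) ≤ length f ℕ.+ length g
  length-*ᵤ []      g = z≤n
  length-*ᵤ (a ∷ f) g = length-+ᵤ-≤ {a ·ᵤ g} {0# ∷ f *ᵤ g} (subst (_≤ _) (sym (length-·ᵤ a g)) (ℕP.m≤n+m (length g) (suc (length f))))
                                    (s≤s (length-*ᵤ f g))

  length-X^ : ∀ d → length (X^ d) ≡ suc d
  length-X^ d = trans (length-X^· d [ 1# ]) (ℕP.+-comm d 1)

  ucoeff-+ᵤ : ∀ f g j → ucoeff (f +ᵤ g) j ≡ ucoeff f j + ucoeff g j
  ucoeff-+ᵤ []      g       j       = sym (+-identityˡ _)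
  ucoeff-+ᵤ (a ∷ f) []      zero    = sym (+-identityʳ _)
  ucoeff-+ᵤ (a ∷ f) []      (suc j) = sym (+-identityʳ _)
  ucoeff-+ᵤ (a ∷ f) (b ∷ g) zero    = refl
  ucoeff-+ᵤ (a ∷ f) (b ∷ g) (suc j) = ucoeff-+ᵤ f g j

  ucoeff-·ᵤ : ∀ c f j → ucoeff (c ·ᵤ f) j ≡ c * ucoeff f j
  ucoeff-·ᵤ c []      j       = sym (zeroʳ c)
  ucoeff-·ᵤ c (a ∷ f) zero    = refl
  ucoeff-·ᵤ c (a ∷ f) (suc j) = ucoeff-·ᵤ c f j

  ucoeff-≥length : ∀ f j → length f ≤ j → ucoeff f j ≡ 0#
  ucoeff-≥length []      j       _         = refl
  ucoeff-≥length (a ∷ f) (suc j) (s≤s f≤j) = ucoeff-≥length f j f≤j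

  ucoeff-X^-same : ∀ d → ucoeff (X^ d) d ≡ 1#
  ucoeff-X^-same zero    = refl
  ucoeff-X^-same (suc d) = ucoeff-X^-same d

  Monic : ℕ → Set
  Monic d = Σ UPoly λ f → length f ≤ d

  monic : ∀ {d} → Monic d → UPoly
  monic {d} (f , _) = f +ᵤ X^ d

  ueval-monic : ∀ {d} (M : Monic d) t → ueval (monic M) t ≡ ueval (proj₁ M) t + pow R t d
  ueval-monic {d} (f , _) t = trans (ueval-+ᵤ f (X^ d) t) (cong (ueval f t +_) (ueval-X^ d t))

  length-monic : ∀ {d} (M : Monic d) → length (monic M) ≤ suc d
  length-monic {d} (f , f≤d) = length-+ᵤ-≤ {f} {X^ d} (ℕP.m≤n⇒m≤1+n f≤d) (ℕP.≤-reflexive (length-X^ d))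

  ucoeff-monic-deg : ∀ {d} (M : Monic d) → ucoeff (monic M) d ≡ 1#
  ucoeff-monic-deg {d} (f , f≤d) = begin
    ucoeff (f +ᵤ X^ d) d         ≡⟨ ucoeff-+ᵤ f (X^ d) d ⟩
    ucoeff f d + ucoeff (X^ d) d ≡⟨ cong₂ _+_ (ucoeff-≥length f d f≤d) (ucoeff-X^-same d) ⟩
    0# + 1#                      ≡⟨ +-identityˡ 1# ⟩
    1#                           ∎

  ucoeff-monic->deg : ∀ {d} (M : Monic d) j → d < j → ucoeff (monic M) j ≡ 0#
  ucoeff-monic->deg M j d<j = ucoeff-≥length (monic M) j (ℕP.≤-trans (length-monic M) d<j)

  1ₘ : Monic 0
  1ₘ = [] , z≤n

  linearₘ : ∀ ω → 1 ≤ ω → Fin k → Monic ω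
  linearₘ ω 1≤ω y = [ y ] , 1≤ω

  _*ₘ_ : ∀ {d e} → Monic d → Monic e → Monic (d ℕ.+ e)
  _*ₘ_ {d} {e} (f , f≤d) (g , g≤e) = f *ᵤ g +ᵤ X^ d · g +ᵤ X^ e · f , length≤
    where
    length≤ : length (f *ᵤ g +ᵤ X^ d · g +ᵤ X^ e · f) ≤ d ℕ.+ e
    length≤ = length-+ᵤ-≤ {f *ᵤ g +ᵤ X^ d · g} {X^ e · f}
      (length-+ᵤ-≤ {f *ᵤ g} {X^ d · g} (ℕP.≤-trans (length-*ᵤ f g) (ℕP.+-mono-≤ f≤d g≤e))
                                       (subst (_≤ _) (sym (length-X^· d g)) (ℕP.+-monoʳ-≤ d g≤e)))
      (subst (_≤ _) (sym (length-X^· e f)) (subst (e ℕ.+ length f ≤_) (ℕP.+-comm e d) (ℕP.+-monoʳ-≤ e f≤d)))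

  ueval-1ₘ : ∀ t → ueval (monic 1ₘ) t ≡ 1#
  ueval-1ₘ t = trans (ueval-monic 1ₘ t) (+-identityˡ 1#)

  ueval-linearₘ : ∀ ω 1≤ω y t → ueval (monic (linearₘ ω 1≤ω y)) t ≡ y + pow R t ω
  ueval-linearₘ ω 1≤ω y t = trans (ueval-monic (linearₘ ω 1≤ω y) t) (cong (_+ pow R t ω) (trans (cong (y +_) (zeroʳ t)) (+-identityʳ y)))

  ueval-*ₘ : ∀ {d e} (M : Monic d) (N : Monic e) t → ueval (monic (M *ₘ N)) t ≡ ueval (monic M) t * ueval (monic N) t
  ueval-*ₘ {d} {e} M@(f , _) N@(g , _) t = begin
    ueval (monic (M *ₘ N)) t
      ≡⟨ ueval-monic (M *ₘ N) t ⟩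
    ueval (f *ᵤ g +ᵤ X^ d · g +ᵤ X^ e · f) t + pow R t (d ℕ.+ e)
      ≡⟨ cong₂ _+_ (trans (ueval-+ᵤ (f *ᵤ g +ᵤ X^ d · g) (X^ e · f) t)
                          (cong₂ _+_ (trans (ueval-+ᵤ (f *ᵤ g) (X^ d · g) t) (cong₂ _+_ (ueval-*ᵤ f g t) (ueval-X^· d g t)))
                                     (ueval-X^· e f t)))
                   (pow-+ t d e) ⟩
    ((ueval f t * ueval g t + tᵈ * ueval g t) + tᵉ * ueval f t) + tᵈ * tᵉ
      ≡⟨ solve 4 (λ a b u v → ((a :* b :+ u :* b) :+ v :* a) :+ u :* v := (a :+ u) :* (b :+ v)) refl (ueval f t) (ueval g t) tᵈ tᵉ ⟩
    (ueval f t + tᵈ) * (ueval g t + tᵉ)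
      ≡⟨ sym (cong₂ _*_ (ueval-monic M t) (ueval-monic N t)) ⟩
    ueval (monic M) t * ueval (monic N) t ∎
    where tᵈ = pow R t d; tᵉ = pow R t e

  -- Synthetic division: divide t a f is the quotient and remainder of a ∷ f by X - t.
  divide : Fin k → Fin k → UPoly → UPoly × Fin k
  divide t a []      = [] , a
  divide t a (b ∷ f) = let (q , r) = divide t b f in r ∷ q , a + t * r

  length-quotient : ∀ t a f → length (proj₁ (divide t a f)) ≡ length f
  length-quotient t a []      = refl
  length-quotient t a (b ∷ f) = cong suc (length-quotient t b f)

  ueval-divide : ∀ t a f x → ueval (a ∷ f) x ≡ (x - t) * ueval (proj₁ (divide t a f)) x + proj₂ (divide t a f)
  ueval-divide t a []      x = solve 3 (λ a x t → a :+ x :* con (ℤ.+ 0) := (x :- t) :* con (ℤ.+ 0) :+ a) refl a x t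
  ueval-divide t a (b ∷ f) x = begin
    a + x * ueval (b ∷ f) x              ≡⟨ cong (λ z → a + x * z) (ueval-divide t b f x) ⟩
    a + x * ((x - t) * ueval q x + r)    ≡⟨ solve 5 (λ a x t u r → a :+ x :* ((x :- t) :* u :+ r) := (x :- t) :* (r :+ x :* u) :+ (a :+ t :* r))
                                                 refl a x t (ueval q x) r ⟩
    (x - t) * (r + x * ueval q x) + (a + t * r) ∎
    where q = proj₁ (divide t b f); r = proj₂ (divide t b f)

  IsZero : UPoly → Set
  IsZero = All (_≡ 0#)

  ucoeff-IsZero : ∀ {f} → IsZero f → ∀ j → ucoeff f j ≡ 0#
  ucoeff-IsZero []           j       = refl
  ucoeff-IsZero (a≡0 ∷ f≡0) zero    = a≡0
  ucoeff-IsZero (a≡0 ∷ f≡0) (suc j) = ucoeff-IsZero f≡0 j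

  divide-IsZero : ∀ t a f → IsZero (proj₁ (divide t a f)) → proj₂ (divide t a f) ≡ 0# → IsZero (a ∷ f)
  divide-IsZero t a []      _             r≡0 = r≡0 ∷ []
  divide-IsZero t a (b ∷ f) (r′≡0 ∷ q′≡0) r≡0 =
    trans (sym (trans (cong (λ z → a + t * z) r′≡0) (trans (cong (a +_) (zeroʳ t)) (+-identityʳ a)))) r≡0
    ∷ divide-IsZero t b f q′≡0 r′≡0

  vanishing⇒IsZero : ∀ f ts → AllPairs Apart ts → All (λ t → ueval f t ≡ 0#) ts → length f ≤ length ts → IsZero f
  vanishing⇒IsZero []      ts        _                  _               _           = []
  vanishing⇒IsZero (a ∷ f) (t ∷ ts) (t#ts ∷ ts-apart) (ft≡0 ∷ fts≡0) (s≤s f≤ts) =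
    divide-IsZero t a f (vanishing⇒IsZero q ts ts-apart (All.zipWith quotient-root (t#ts , fts≡0))
                                          (subst (_≤ length ts) (sym (length-quotient t a f)) f≤ts))
                        remainder≡0
    where
    q = proj₁ (divide t a f)
    r = proj₂ (divide t a f)
    remainder≡0 : r ≡ 0#
    remainder≡0 = begin
      r                            ≡⟨ solve 2 (λ u r → r := con (ℤ.+ 0) :* u :+ r) refl (ueval q t) r ⟩
      0# * ueval q t + r           ≡⟨ cong (λ z → z * ueval q t + r) (sym (-‿inverseʳ t)) ⟩
      (t - t) * ueval q t + r      ≡⟨ sym (ueval-divide t a f t) ⟩
      ueval (a ∷ f) t              ≡⟨ ft≡0 ⟩
      0#                           ∎
    quotient-root : ∀ {u} → Apart t u × ueval (a ∷ f) u ≡ 0# → ueval q u ≡ 0#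
    quotient-root {u} (t#u , fu≡0) = unit-cancel t#u (begin
      (u - t) * ueval q u          ≡⟨ sym (+-identityʳ _) ⟩
      (u - t) * ueval q u + 0#     ≡⟨ cong ((u - t) * ueval q u +_) (sym remainder≡0) ⟩
      (u - t) * ueval q u + r      ≡⟨ sym (ueval-divide t a f u) ⟩
      ueval (a ∷ f) u              ≡⟨ fu≡0 ⟩
      0#                           ∎)

  roots-≤ : ∀ g e ts → length g ≤ suc e → ucoeff g e ≢ 0# →
            AllPairs Apart ts → All (λ t → ueval g t ≡ 0#) ts → length ts ≤ e
  roots-≤ g e ts g≤1+e gₑ≢0 ts-apart g[ts]≡0 with length ts ℕ.≤? e
  ... | yes ts≤e = ts≤e
  ... | no  ts≰e = ⊥-elim (gₑ≢0 (ucoeff-IsZero (vanishing⇒IsZero g ts ts-apart g[ts]≡0 (ℕP.≤-trans g≤1+e (ℕP.≰⇒> ts≰e))) e))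

-- Kronecker weights: exponent vectors read as base-W numerals

weight : ∀ {n} → Vec ℕ n → Vec ℕ n → ℕ
weight []       []      = 0
weight (w ∷ ws) (b ∷ β) = b ℕ.* w ℕ.+ weight ws β

powers : ℕ → (n : ℕ) → Vec ℕ n
powers W zero    = []
powers W (suc n) = 1 ∷ Vec.map (W ℕ.*_) (powers W n)

powers-positive : ∀ W → 1 ≤ W → ∀ n → VAll.All (1 ≤_) (powers W n)
powers-positive W 1≤W zero    = VAll.[]
powers-positive W 1≤W (suc n) = s≤s z≤n VAll.∷ VAllP.map⁺ (VAll.map (ℕP.*-mono-≤ 1≤W) (powers-positive W 1≤W n))

weight-powers-∷ : ∀ {n} W b (β : Vec ℕ n) → weight (powers W (suc n)) (b ∷ β) ≡ b ℕ.+ W ℕ.* weight (powers W n) β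
weight-powers-∷ W b β = cong₂ ℕ._+_ (ℕP.*-identityʳ b) (weight-map W (powers W _) β)
  where
  weight-map : ∀ {n} W (ws : Vec ℕ n) β → weight (Vec.map (W ℕ.*_) ws) β ≡ W ℕ.* weight ws β
  weight-map W []       []      = sym (ℕP.*-zeroʳ W)
  weight-map W (w ∷ ws) (b ∷ β) = trans (cong₂ ℕ._+_ (swap b W w) (weight-map W ws β)) (sym (ℕP.*-distribˡ-+ W (b ℕ.* w) _))
    where
    swap : ∀ b W w → b ℕ.* (W ℕ.* w) ≡ W ℕ.* (b ℕ.* w)
    swap = solve-∀

weight-powers-injective : ∀ {n} W .{{_ : NonZero W}} (β β′ : Vec ℕ n) → VAll.All (_< W) β → VAll.All (_< W) β′ →
                          weight (powers W n) β ≡ weight (powers W n) β′ → β ≡ β′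
weight-powers-injective W []      []        _               _                 _ = refl
weight-powers-injective {suc n} W (b ∷ β) (b′ ∷ β′) (b<W VAll.∷ β<W) (b′<W VAll.∷ β′<W) eq =
  cong₂ _∷_ b≡b′ (weight-powers-injective W β β′ β<W β′<W rest≡)
  where
  x = weight (powers W n) β; x′ = weight (powers W n) β′
  eq′ : b ℕ.+ x ℕ.* W ≡ b′ ℕ.+ x′ ℕ.* W
  eq′ = trans (cong (b ℕ.+_) (ℕP.*-comm x W))
          (trans (sym (weight-powers-∷ W b β)) (trans eq (trans (weight-powers-∷ W b′ β′) (cong (b′ ℕ.+_) (ℕP.*-comm W x′)))))
  digit : ∀ c y → c < W → (c ℕ.+ y ℕ.* W) % W ≡ c
  digit c y c<W = trans ([m+kn]%n≡m%n c y W) (m<n⇒m%n≡m c<W)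
  b≡b′ : b ≡ b′
  b≡b′ = trans (sym (digit b x b<W)) (trans (cong (_% W) eq′) (digit b′ x′ b′<W))
  rest≡ : x ≡ x′
  rest≡ = ℕP.*-cancelʳ-≡ x x′ W (ℕP.+-cancelˡ-≡ b _ _ (trans eq′ (cong (ℕ._+ _) (sym b≡b′))))

_≟ᵛ_ : ∀ {n} (α β : Vec ℕ n) → Dec (α ≡ β)
_≟ᵛ_ = ≡-dec ℕ._≟_

coeff-∉ : ∀ {n} (Q : Poly n) α → α ∉ map proj₁ Q → coeff Q α ≡ ℤ.+ 0
coeff-∉ []            α _   = refl
coeff-∉ ((β , c) ∷ Q) α α∉Q with β ≟ᵛ α
... | yes β≡α = ⊥-elim (α∉Q (here (sym β≡α)))
... | no  _   = trans (ℤP.+-identityˡ _) (coeff-∉ Q α (α∉Q ∘ there))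

module Support {n : ℕ} (Q : Poly n) where

  exponents : List (Vec ℕ n)
  exponents = map proj₁ Q

  nonzero? : ∀ β → Dec (coeff Q β ≢ ℤ.+ 0)
  nonzero? β = ¬? (coeff Q β ℤ.≟ ℤ.+ 0)

  support : List (Vec ℕ n)
  support = filter nonzero? (deduplicate _≟ᵛ_ exponents)

  base : ℕ
  base = suc (Extremaℕ.max 0 (concatMap Vec.toList exponents))

  weights : Vec ℕ n
  weights = powers base n

  leading : Vec ℕ n
  leading = Extremaℕ.argmax (weight weights) (Vec.replicate n 0) support

  degree : ℕ
  degree = weight weights leading

  height : ℕ
  height = Σℕ.sum support (ℤ.∣_∣ ∘ coeff Q)

  support-unique : Unique support
  support-unique = UniqueP.filter⁺ nonzero? (UniqueDecP.deduplicate-! _≟ᵛ_ exponents)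

  ∈support⇒ : ∀ {α} → α ∈ support → α ∈ exponents × coeff Q α ≢ ℤ.+ 0
  ∈support⇒ α∈ with ∈P.∈-filter⁻ nonzero? {xs = deduplicate _≟ᵛ_ exponents} α∈
  ... | α∈dedup , cα≢0 = ∈P.∈-deduplicate⁻ _≟ᵛ_ exponents α∈dedup , cα≢0

  coeff≢0⇒∈support : ∀ {α} → coeff Q α ≢ ℤ.+ 0 → α ∈ support
  coeff≢0⇒∈support {α} cα≢0 with DecMembership._∈?_ _≟ᵛ_ α exponents
  ... | yes α∈ = ∈P.∈-filter⁺ nonzero? (∈P.∈-deduplicate⁺ _≟ᵛ_ α∈) cα≢0
  ... | no  α∉ = ⊥-elim (cα≢0 (coeff-∉ Q α α∉))

  exponent<base : ∀ {α} → α ∈ exponents → VAll.All (_< base) α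
  exponent<base α∈ = VAll.map s≤s (VAllP.toList⁻ (All.lookup (AllP.map⁻ (AllP.concat⁻ (Extremaℕ.xs≤max 0 _))) α∈))

  weight≤degree : ∀ {α} → α ∈ support → weight weights α ≤ degree
  weight≤degree = All.lookup (Extremaℕ.f[xs]≤f[argmax] (Vec.replicate n 0) support)

  degree-attained : ∀ {α} → α ∈ support → ∃ λ β → β ∈ support × weight weights β ≡ degree
  degree-attained {α} α∈ with Extremaℕ.argmax-sel (weight weights) (Vec.replicate n 0) support
  ... | inj₂ leading∈ = leading , leading∈ , refl
  ... | inj₁ leading≡0 = α , α∈ , ℕP.≤-antisym (weight≤degree α∈) (ℕP.≤-trans (ℕP.≤-reflexive degree≡0) z≤n)
    where
    weight-zeros : ∀ {m} (ws : Vec ℕ m) → weight ws (Vec.replicate m 0) ≡ 0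
    weight-zeros []       = refl
    weight-zeros (w ∷ ws) = weight-zeros ws
    degree≡0 : degree ≡ 0
    degree≡0 = trans (cong (weight weights) leading≡0) (weight-zeros weights)

  weight-injective : ∀ {α β} → α ∈ support → β ∈ support → weight weights α ≡ weight weights β → α ≡ β
  weight-injective α∈ β∈ = weight-powers-injective base _ _
    (exponent<base (proj₁ (∈support⇒ α∈))) (exponent<base (proj₁ (∈support⇒ β∈)))

  ∣coeff∣≤height : ∀ {α} → α ∈ support → ℤ.∣ coeff Q α ∣ ≤ height
  ∣coeff∣≤height = Σℕ.≤-sum support (ℤ.∣_∣ ∘ coeff Q)

module Evaluation {k : ℕ} (R : FinCommRing k) where
  open RingFacts R
  module ΣR = ListSum +-isCommutativeMonoid
  open ≡-Reasoning

  term : ∀ {n} → Poly n → Vec (Fin k) n → Vec ℕ n → Fin k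
  term Q z β = intCast R (coeff Q β) * monomial R β z

  eval-as-sum : ∀ {n} (Q : Poly n) (S : List (Vec ℕ n)) z → Unique S → All (_∈ S) (map proj₁ Q) →
                eval R Q z ≡ ΣR.sum S (term Q z)
  eval-as-sum []              S z S! _ = sym (ΣR.sum-zero S (λ β _ → zeroˡ _))
  eval-as-sum {n} ((β₀ , c₀) ∷ Q) S z S! (β₀∈S ∷ Q⊆S) = begin
    intCast R c₀ * monomial R β₀ z + eval R Q z            ≡⟨ cong₂ _+_ (sym head-term) (eval-as-sum Q S z S! Q⊆S) ⟩
    ΣR.sum S (term [ β₀ , c₀ ] z) + ΣR.sum S (term Q z)    ≡⟨ sym (ΣR.sum-∙ S _ _) ⟩
    ΣR.sum S (λ β → term [ β₀ , c₀ ] z β + term Q z β)     ≡⟨ ΣR.sum-cong S (λ β _ → merge β) ⟩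
    ΣR.sum S (term ((β₀ , c₀) ∷ Q) z)                      ∎
    where
    head-coeff : Vec ℕ n → ℤ
    head-coeff β = if does (β₀ ≟ᵛ β) then c₀ else ℤ.+ 0
    head-term : ΣR.sum S (term [ β₀ , c₀ ] z) ≡ intCast R c₀ * monomial R β₀ z
    head-term = trans (ΣR.sum-single S S! β₀∈S (λ β _ β≢β₀ → trans (cong (λ c → intCast R c * monomial R β z) (other β β≢β₀)) (zeroˡ _)))
                      (cong (λ c → intCast R c * monomial R β₀ z) same)
      where
      same : coeff [ β₀ , c₀ ] β₀ ≡ c₀
      same with β₀ ≟ᵛ β₀
      ... | yes _      = ℤP.+-identityʳ c₀
      ... | no  β₀≢β₀ = ⊥-elim (β₀≢β₀ refl)
      other : ∀ β → β ≢ β₀ → coeff [ β₀ , c₀ ] β ≡ ℤ.+ 0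
      other β β≢β₀ with β₀ ≟ᵛ β
      ... | yes β₀≡β = ⊥-elim (β≢β₀ (sym β₀≡β))
      ... | no  _     = refl
    merge : ∀ β → term [ β₀ , c₀ ] z β + term Q z β ≡ term ((β₀ , c₀) ∷ Q) z β
    merge β = begin
      intCast R (head-coeff β ℤ.+ ℤ.+ 0) * monomial R β z + intCast R (coeff Q β) * monomial R β z
        ≡⟨ sym (distribʳ _ _ _) ⟩
      (intCast R (head-coeff β ℤ.+ ℤ.+ 0) + intCast R (coeff Q β)) * monomial R β z
        ≡⟨ cong (_* monomial R β z) (sym (intCast-+ (head-coeff β ℤ.+ ℤ.+ 0) (coeff Q β))) ⟩
      intCast R ((head-coeff β ℤ.+ ℤ.+ 0) ℤ.+ coeff Q β) * monomial R β z
        ≡⟨ cong (λ c → intCast R (c ℤ.+ coeff Q β) * monomial R β z) (ℤP.+-identityʳ (head-coeff β)) ⟩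
      intCast R (head-coeff β ℤ.+ coeff Q β) * monomial R β z ∎

  eval-as-sum-support : ∀ {n} (Q : Poly n) z → eval R Q z ≡ ΣR.sum (Support.support Q) (term Q z)
  eval-as-sum-support Q z = begin
    eval R Q z                                 ≡⟨ eval-as-sum Q dedup z (UniqueDecP.deduplicate-! _≟ᵛ_ exponents)
                                                              (All.tabulate (∈P.∈-deduplicate⁺ _≟ᵛ_)) ⟩
    ΣR.sum dedup (term Q z)                    ≡⟨ sym (ΣR.sum-filter nonzero? dedup vanishing-term) ⟩
    ΣR.sum (filter nonzero? dedup) (term Q z)  ∎
    where
    open Support Q
    dedup = deduplicate _≟ᵛ_ exponents
    vanishing-term : ∀ β → ¬ (coeff Q β ≢ ℤ.+ 0) → term Q z β ≡ 0#
    vanishing-term β ¬cβ≢0 with coeff Q β ℤ.≟ ℤ.+ 0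
    ... | yes cβ≡0 = trans (cong (λ c → intCast R c * monomial R β z) cβ≡0) (zeroˡ _)
    ... | no  cβ≢0 = ⊥-elim (¬cβ≢0 cβ≢0)

-- Restricting a polynomial to the curve t ↦ y + (t ^ w₁, …, t ^ wₙ)

module Restriction {k : ℕ} (R : FinCommRing k) where
  open RingFacts R
  open Univariate R
  open Evaluation R
  open ≡-Reasoning

  translate : ∀ {n} → Vec ℕ n → Vec (Fin k) n → Fin k → Vec (Fin k) n
  translate []       []       t = []
  translate (w ∷ ws) (y ∷ ys) t = (y + pow R t w) ∷ translate ws ys t

  powerₘ : ∀ ω → 1 ≤ ω → Fin k → (b : ℕ) → Monic (b ℕ.* ω)
  powerₘ ω 1≤ω y zero    = 1ₘ
  powerₘ ω 1≤ω y (suc b) = linearₘ ω 1≤ω y *ₘ powerₘ ω 1≤ω y b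

  ueval-powerₘ : ∀ ω 1≤ω y b t → ueval (monic (powerₘ ω 1≤ω y b)) t ≡ pow R (y + pow R t ω) b
  ueval-powerₘ ω 1≤ω y zero    t = ueval-1ₘ t
  ueval-powerₘ ω 1≤ω y (suc b) t =
    trans (ueval-*ₘ (linearₘ ω 1≤ω y) (powerₘ ω 1≤ω y b) t) (cong₂ _*_ (ueval-linearₘ ω 1≤ω y t) (ueval-powerₘ ω 1≤ω y b t))

  monomialₘ : ∀ {n} (ws : Vec ℕ n) → VAll.All (1 ≤_) ws → (β : Vec ℕ n) → Vec (Fin k) n → Monic (weight ws β)
  monomialₘ []       _                  []      []       = 1ₘ
  monomialₘ (w ∷ ws) (1≤w VAll.∷ ws≥1) (b ∷ β) (y ∷ ys) = powerₘ w 1≤w y b *ₘ monomialₘ ws ws≥1 β ys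

  ueval-monomialₘ : ∀ {n} (ws : Vec ℕ n) ws≥1 β y t → ueval (monic (monomialₘ ws ws≥1 β y)) t ≡ monomial R β (translate ws y t)
  ueval-monomialₘ []       _                  []      []       t = ueval-1ₘ t
  ueval-monomialₘ (w ∷ ws) (1≤w VAll.∷ ws≥1) (b ∷ β) (y ∷ ys) t =
    trans (ueval-*ₘ (powerₘ w 1≤w y b) (monomialₘ ws ws≥1 β ys) t)
          (cong₂ _*_ (ueval-powerₘ w 1≤w y b t) (ueval-monomialₘ ws ws≥1 β ys t))

  module _ {n : ℕ} (Q : Poly n) where
    open Support Q

    monomialₘ′ : Vec (Fin k) n → (β : Vec ℕ n) → Monic (weight weights β)
    monomialₘ′ y β = monomialₘ weights (powers-positive base (s≤s z≤n) n) β y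

    monomialᵤ : Vec (Fin k) n → (β : Vec ℕ n) → UPoly
    monomialᵤ y β = monic (monomialₘ′ y β)

    restrictionOver : List (Vec ℕ n) → Vec (Fin k) n → UPoly
    restrictionOver L y = foldr (λ β g → intCast R (coeff Q β) ·ᵤ monomialᵤ y β +ᵤ g) [] L

    restriction : Vec (Fin k) n → UPoly
    restriction = restrictionOver support

    ueval-restrictionOver : ∀ L y t → ueval (restrictionOver L y) t ≡ ΣR.sum L (λ β → intCast R (coeff Q β) * ueval (monomialᵤ y β) t)
    ueval-restrictionOver []      y t = refl
    ueval-restrictionOver (β ∷ L) y t =
      trans (ueval-+ᵤ (intCast R (coeff Q β) ·ᵤ monomialᵤ y β) (restrictionOver L y) t)
            (cong₂ _+_ (ueval-·ᵤ (intCast R (coeff Q β)) (monomialᵤ y β) t) (ueval-restrictionOver L y t))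

    ucoeff-restrictionOver : ∀ L y j → ucoeff (restrictionOver L y) j ≡ ΣR.sum L (λ β → intCast R (coeff Q β) * ucoeff (monomialᵤ y β) j)
    ucoeff-restrictionOver []      y j = refl
    ucoeff-restrictionOver (β ∷ L) y j =
      trans (ucoeff-+ᵤ (intCast R (coeff Q β) ·ᵤ monomialᵤ y β) (restrictionOver L y) j)
            (cong₂ _+_ (ucoeff-·ᵤ (intCast R (coeff Q β)) (monomialᵤ y β) j) (ucoeff-restrictionOver L y j))

    length-restrictionOver : ∀ L y → (∀ β → β ∈ L → weight weights β ≤ degree) → length (restrictionOver L y) ≤ suc degree
    length-restrictionOver []      y _ = z≤n
    length-restrictionOver (β ∷ L) y L≤degree =
      length-+ᵤ-≤ {intCast R (coeff Q β) ·ᵤ monomialᵤ y β} {restrictionOver L y}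
        (subst (_≤ _) (sym (length-·ᵤ _ (monomialᵤ y β))) (ℕP.≤-trans (length-monic (monomialₘ′ y β)) (s≤s (L≤degree β (here refl)))))
        (length-restrictionOver L y (λ β′ β′∈L → L≤degree β′ (there β′∈L)))

    eval-translate : ∀ y t → eval R Q (translate weights y t) ≡ ueval (restriction y) t
    eval-translate y t = begin
      eval R Q (translate weights y t)                                   ≡⟨ eval-as-sum-support Q _ ⟩
      ΣR.sum support (term Q (translate weights y t))                   ≡⟨ ΣR.sum-cong support (λ β _ → cong (intCast R (coeff Q β) *_)
                                                                             (sym (ueval-monomialₘ weights _ β y t))) ⟩
      ΣR.sum support (λ β → intCast R (coeff Q β) * ueval (monomialᵤ y β) t) ≡⟨ sym (ueval-restrictionOver support y t) ⟩
      ueval (restriction y) t                                            ∎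

    -- Distinct exponents of the support have distinct weights, so only the leading one reaches the degree.
    ucoeff-restriction-degree : ∀ y {α} → α ∈ support → weight weights α ≡ degree → ucoeff (restriction y) degree ≡ intCast R (coeff Q α)
    ucoeff-restriction-degree y {α} α∈ α-leading = begin
      ucoeff (restriction y) degree                                          ≡⟨ ucoeff-restrictionOver support y degree ⟩
      ΣR.sum support (λ β → intCast R (coeff Q β) * ucoeff (monomialᵤ y β) degree) ≡⟨ ΣR.sum-single support support-unique α∈ lower ⟩
      intCast R (coeff Q α) * ucoeff (monomialᵤ y α) degree                  ≡⟨ cong (intCast R (coeff Q α) *_) top ⟩
      intCast R (coeff Q α) * 1#                                             ≡⟨ *-identityʳ _ ⟩
      intCast R (coeff Q α)                                                  ∎
      where
      top : ucoeff (monomialᵤ y α) degree ≡ 1#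
      top = subst (λ j → ucoeff (monomialᵤ y α) j ≡ 1#) α-leading (ucoeff-monic-deg (monomialₘ′ y α))
      lower : ∀ β → β ∈ support → β ≢ α → intCast R (coeff Q β) * ucoeff (monomialᵤ y β) degree ≡ 0#
      lower β β∈ β≢α = trans (cong (intCast R (coeff Q β) *_) (ucoeff-monic->deg (monomialₘ′ y β) degree β<degree)) (zeroʳ _)
        where β<degree = ℕP.≤∧≢⇒< (weight≤degree β∈) (λ eq → β≢α (weight-injective β∈ α∈ (trans eq (sym α-leading))))

    roots-on-curve-≤ : ∀ {x} → x ∈ support → (∀ β → β ∈ support → Unit (intCast R (coeff Q β))) →
                       ∀ y ts → AllPairs Apart ts → All (λ t → eval R Q (translate weights y t) ≡ 0#) ts → length ts ≤ degree
    roots-on-curve-≤ x∈ units y ts ts-apart roots with degree-attained x∈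
    ... | α , α∈ , α-leading =
      roots-≤ (restriction y) degree ts (length-restrictionOver support y (λ β → weight≤degree)) top≢0 ts-apart
              (All.map (λ {t} → trans (sym (eval-translate y t))) roots)
      where
      top≢0 : ucoeff (restriction y) degree ≢ 0#
      top≢0 = unit⇒≢0 (units α α∈) ∘ trans (sym (ucoeff-restriction-degree y α∈ α-leading))

-- Counting zeros by averaging over curves

module Counting {k : ℕ} (R : FinCommRing k) where
  open RingFacts R
  open Univariate R
  open Restriction R

  length-allFin : length (allFin k) ≡ k
  length-allFin = ListP.length-tabulate id

  sum-allVecs-suc : ∀ n (f : Vec (Fin k) (suc n) → ℕ) →
                    Σℕ.sum (allVecs R (suc n)) f ≡ Σℕ.sum (allVecs R n) (λ v → Σℕ.sum (allFin k) (λ a → f (a ∷ v)))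
  sum-allVecs-suc n f = trans (Σℕ.sum-concatMap (λ v → map (_∷ v) (allFin k)) (allVecs R n) f)
                              (Σℕ.sum-cong (allVecs R n) (λ v _ → Σℕ.sum-map (_∷ v) (allFin k) f))

  length-allVecs : ∀ n → length (allVecs R n) ≡ k ℕ.^ n
  length-allVecs zero    = refl
  length-allVecs (suc n) = begin
    length (allVecs R (suc n))                                    ≡⟨ sym (ℕP.*-identityʳ _) ⟩
    length (allVecs R (suc n)) ℕ.* 1                               ≡⟨ sym (Σℕ.sum-const (allVecs R (suc n)) 1) ⟩
    Σℕ.sum (allVecs R (suc n)) (λ _ → 1)                          ≡⟨ sum-allVecs-suc n (λ _ → 1) ⟩
    Σℕ.sum (allVecs R n) (λ _ → Σℕ.sum (allFin k) (λ _ → 1))      ≡⟨ Σℕ.sum-const (allVecs R n) _ ⟩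
    length (allVecs R n) ℕ.* Σℕ.sum (allFin k) (λ _ → 1)          ≡⟨ cong₂ ℕ._*_ (length-allVecs n) (Σℕ.sum-const (allFin k) 1) ⟩
    k ℕ.^ n ℕ.* (length (allFin k) ℕ.* 1)                          ≡⟨ cong (λ m → k ℕ.^ n ℕ.* m) (trans (ℕP.*-identityʳ _) length-allFin) ⟩
    k ℕ.^ n ℕ.* k                                                  ≡⟨ ℕP.*-comm (k ℕ.^ n) k ⟩
    k ℕ.^ suc n                                                    ∎
    where open ≡-Reasoning

  sum-allFin-+ : ∀ c (f : Fin k → ℕ) → Σℕ.sum (allFin k) (λ a → f (a + c)) ≡ Σℕ.sum (allFin k) f
  sum-allFin-+ c = Σℕ.sum-permute (permutation (_+ c) (_- c)
    (λ y → solve 2 (λ y c → (y :- c) :+ c := y) refl y c)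
    (λ x → solve 2 (λ x c → (x :+ c) :- c := x) refl x c))

  sum-allVecs-translate : ∀ {n} (ws : Vec ℕ n) t (f : Vec (Fin k) n → ℕ) →
                          Σℕ.sum (allVecs R n) (λ y → f (translate ws y t)) ≡ Σℕ.sum (allVecs R n) f
  sum-allVecs-translate []               t f = refl
  sum-allVecs-translate {suc n} (w ∷ ws) t f = begin
    Σℕ.sum (allVecs R (suc n)) (λ y → f (translate (w ∷ ws) y t))
      ≡⟨ sum-allVecs-suc n _ ⟩
    Σℕ.sum (allVecs R n) (λ v → Σℕ.sum (allFin k) (λ a → f ((a + pow R t w) ∷ translate ws v t)))
      ≡⟨ Σℕ.sum-cong (allVecs R n) (λ v _ → sum-allFin-+ (pow R t w) (λ a → f (a ∷ translate ws v t))) ⟩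
    Σℕ.sum (allVecs R n) (λ v → Σℕ.sum (allFin k) (λ a → f (a ∷ translate ws v t)))
      ≡⟨ sum-allVecs-translate ws t (λ v → Σℕ.sum (allFin k) (λ a → f (a ∷ v))) ⟩
    Σℕ.sum (allVecs R n) (λ v → Σℕ.sum (allFin k) (λ a → f (a ∷ v)))
      ≡⟨ sym (sum-allVecs-suc n f) ⟩
    Σℕ.sum (allVecs R (suc n)) f ∎
    where open ≡-Reasoning

  zeros : ∀ {n} → Poly n → ℕ
  zeros {n} Q = Σℕ.sum (allVecs R n) (λ y → Σℕ.indicator (eval R Q y FinP.≟ 0#))

  -- Each curve y + (t ^ w) meets the zero set in at most degree Q of the points ts, and the curves through
  -- the different points t cover Rⁿ equally often.
  zeros-bound : ∀ {n} (Q : Poly n) {x} → x ∈ Support.support Q →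
                (∀ β → β ∈ Support.support Q → Unit (intCast R (coeff Q β))) →
                ∀ ts → AllPairs Apart ts → length ts ℕ.* zeros Q ≤ k ℕ.^ n ℕ.* Support.degree Q
  zeros-bound {n} Q x∈ units ts ts-apart = begin
    length ts ℕ.* zeros Q                                        ≡⟨ sym (Σℕ.sum-const ts (zeros Q)) ⟩
    Σℕ.sum ts (λ t → zeros Q)                                    ≡⟨ Σℕ.sum-cong ts (λ t _ → sym (sum-allVecs-translate weights t vanishes)) ⟩
    Σℕ.sum ts (λ t → Σℕ.sum (allVecs R n) (λ y → vanishes (translate weights y t))) ≡⟨ Σℕ.sum-swap ts (allVecs R n) _ ⟩
    Σℕ.sum (allVecs R n) (λ y → Σℕ.sum ts (λ t → vanishes (translate weights y t))) ≤⟨ Σℕ.sum-mono (allVecs R n) (λ y _ → on-curve y) ⟩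
    Σℕ.sum (allVecs R n) (λ _ → degree)                          ≡⟨ Σℕ.sum-const (allVecs R n) degree ⟩
    length (allVecs R n) ℕ.* degree                              ≡⟨ cong (ℕ._* degree) (length-allVecs n) ⟩
    k ℕ.^ n ℕ.* degree                                           ∎
    where
    open Support Q
    open ℕP.≤-Reasoning
    vanishes : Vec (Fin k) n → ℕ
    vanishes y = Σℕ.indicator (eval R Q y FinP.≟ 0#)
    on-curve : ∀ y → Σℕ.sum ts (λ t → vanishes (translate weights y t)) ≤ degree
    on-curve y = subst (_≤ degree) (sym (Σℕ.sum-indicator root? ts))
      (roots-on-curve-≤ Q x∈ units y _ (AllPairsP.filter⁺ root? ts-apart) (AllP.all-filter root? ts))
      where root? = λ t → eval R Q (translate weights y t) FinP.≟ 0#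

-- Units below the least prime factor of the characteristic

coprime-below-lpf : ∀ {p N d} → (∀ q → Prime q → q ∣ N → p ≤ q) → 0 < d → d < p → Coprime d N
coprime-below-lpf {p} {N} {d} lpf 0<d d<p {i} (i∣d , i∣N) = from-factorisation (factorise i)
  where
  instance
    d≢0 = ℕ.>-nonZero 0<d
    i≢0 = ℕ.≢-nonZero (λ i≡0 → ℕP.<⇒≢ 0<d (sym (0∣⇒≡0 (subst (_∣ d) i≡0 i∣d))))
  from-factorisation : PrimeFactorisation i → i ≡ 1
  from-factorisation record { factors = []     ; isFactorisation = i≡1 } = i≡1
  from-factorisation record { factors = q ∷ qs ; isFactorisation = i≡∏ ; factorsPrime = q-prime ∷ _ } =
    ⊥-elim (ℕP.<-irrefl refl (ℕP.≤-<-trans p≤i (ℕP.≤-<-trans (∣⇒≤ i∣d) d<p)))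
    where
    q∣i : q ∣ i
    q∣i = subst (q ∣_) (sym i≡∏) (∈⇒∣product {ns = q ∷ qs} (here refl))
    p≤i : p ≤ i
    p≤i = ℕP.≤-trans (lpf q q-prime (∣-trans q∣i i∣N)) (∣⇒≤ q∣i)

module SmallUnits {k : ℕ} (R : FinCommRing k) {N p : ℕ} (char : IsCharacteristic R N) (lpf : IsLpf p N) where
  open RingFacts R
  open ≡-Reasoning

  natCast-multiple : ∀ y → natCast R (y ℕ.* N) ≡ 0#
  natCast-multiple y = trans (natCast-* y N) (trans (cong (natCast R y *_) (proj₁ (proj₂ char))) (zeroʳ _))

  natCast-1+multiple : ∀ y → natCast R (1 ℕ.+ y ℕ.* N) ≡ 1#
  natCast-1+multiple y = trans (cong (1# +_) (natCast-multiple y)) (+-identityʳ 1#)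

  -- The inverse comes from a Bézout identity for d and N, since natCast R N ≡ 0#.
  natCast-unit : ∀ {d} → 0 < d → d < p → Unit (natCast R d)
  natCast-unit {d} 0<d d<p with coprime-Bézout (coprime-below-lpf (proj₂ (proj₂ lpf)) 0<d d<p)
  ... | Bézout.+- a b 1+bN≡ad = natCast R a , (begin
    natCast R a * natCast R d  ≡⟨ sym (natCast-* a d) ⟩
    natCast R (a ℕ.* d)        ≡⟨ cong (natCast R) (sym 1+bN≡ad) ⟩
    natCast R (1 ℕ.+ b ℕ.* N)  ≡⟨ natCast-1+multiple b ⟩
    1#                         ∎)
  ... | Bézout.-+ a b 1+ad≡bN = - natCast R a , (begin
    - natCast R a * natCast R d                        ≡⟨ solve 3 (λ x y o → :- x :* y := :- (o :+ x :* y) :+ o) refl (natCast R a) (natCast R d) 1# ⟩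
    - (1# + natCast R a * natCast R d) + 1#            ≡⟨ cong (λ z → - (1# + z) + 1#) (sym (natCast-* a d)) ⟩
    - natCast R (1 ℕ.+ a ℕ.* d) + 1#                    ≡⟨ cong (λ z → - natCast R z + 1#) 1+ad≡bN ⟩
    - natCast R (b ℕ.* N) + 1#                          ≡⟨ cong (λ z → - z + 1#) (natCast-multiple b) ⟩
    - 0# + 1#                                          ≡⟨ cong (_+ 1#) -0#≡0# ⟩
    0# + 1#                                            ≡⟨ +-identityˡ 1# ⟩
    1#                                                 ∎)

  natCast-apart : ∀ {i j} → i < j → j < p → Apart (natCast R i) (natCast R j)
  natCast-apart {i} {j} i<j j<p = subst Unit difference (natCast-unit (ℕP.m<n⇒0<n∸m i<j) (ℕP.≤-<-trans (ℕP.m∸n≤m j i) j<p))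
    where
    difference : natCast R (j ℕ.∸ i) ≡ natCast R j - natCast R i
    difference = begin
      natCast R (j ℕ.∸ i)                                  ≡⟨ solve 2 (λ a b → b := (a :+ b) :- a) refl (natCast R i) _ ⟩
      (natCast R i + natCast R (j ℕ.∸ i)) - natCast R i    ≡⟨ cong (_- natCast R i) (sym (natCast-+ i (j ℕ.∸ i))) ⟩
      natCast R (i ℕ.+ (j ℕ.∸ i)) - natCast R i            ≡⟨ cong (λ m → natCast R m - natCast R i) (ℕP.m+[n∸m]≡n (ℕP.<⇒≤ i<j)) ⟩
      natCast R j - natCast R i                            ∎

  intCast-unit : ∀ {c} → c ≢ ℤ.+ 0 → ℤ.∣ c ∣ < p → Unit (intCast R c)
  intCast-unit {ℤ.+ zero}  c≢0 _   = ⊥-elim (c≢0 refl)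
  intCast-unit {ℤ.+ suc n} _   c<p = natCast-unit (s≤s z≤n) c<p
  intCast-unit { -[1+ n ]} _   c<p = -‿unit (natCast-unit (s≤s z≤n) c<p)

negate : ∀ {n} → Poly n → Poly n
negate = map (λ (α , c) → α , ℤ.- c)

coeff-++ : ∀ {n} (A B : Poly n) α → coeff (A ++ B) α ≡ coeff A α ℤ.+ coeff B α
coeff-++ []            B α = sym (ℤP.+-identityˡ _)
coeff-++ ((β , c) ∷ A) B α = trans (cong (λ z → cβ ℤ.+ z) (coeff-++ A B α)) (sym (ℤP.+-assoc cβ (coeff A α) (coeff B α)))
  where cβ = if does (β ≟ᵛ α) then c else ℤ.+ 0

coeff-negate : ∀ {n} (A : Poly n) α → coeff (negate A) α ≡ ℤ.- coeff A α
coeff-negate []            α = refl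
coeff-negate ((β , c) ∷ A) α with does (β ≟ᵛ α)
... | true  = trans (cong (λ z → ℤ.- c ℤ.+ z) (coeff-negate A α)) (sym (ℤP.neg-distrib-+ c (coeff A α)))
... | false = trans (cong (λ z → ℤ.+ 0 ℤ.+ z) (coeff-negate A α)) (sym (ℤP.neg-distrib-+ (ℤ.+ 0) (coeff A α)))

module Family {n m : ℕ} (P : Fin m → Poly n) where

  difference : Fin m → Fin m → Poly n
  difference i j = P i ++ negate (P j)

  others : Fin m → List (Fin m)
  others i = filter (λ j → ¬? (i FinP.≟ j)) (allFin m)

  family : List (Poly n)
  family = map P (allFin m) ++ concatMap (λ i → map (difference i) (others i)) (allFin m)

  P∈family : ∀ i → P i ∈ family
  P∈family i = ∈P.∈-++⁺ˡ (∈P.∈-map⁺ P (∈P.∈-allFin i))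

  difference∈family : ∀ {i j} → i ≢ j → difference i j ∈ family
  difference∈family {i} {j} i≢j = ∈P.∈-++⁺ʳ (map P (allFin m))
    (∈P.∈-concatMap⁺ (λ i → map (difference i) (others i)) (Any.map (λ { refl → ∈P.∈-map⁺ (difference i) j∈others }) (∈P.∈-allFin i)))
    where
    j∈others : j ∈ others i
    j∈others = ∈P.∈-filter⁺ (λ j → ¬? (i FinP.≟ j)) (∈P.∈-allFin j) i≢j

  δ : Fin m → Fin m → ℤ
  δ i l = if does (l FinP.≟ i) then ℤ.+ 1 else ℤ.+ 0

  δ-same : ∀ i → δ i i ≡ ℤ.+ 1
  δ-same i with i FinP.≟ i
  ... | yes _   = refl
  ... | no  i≢i = ⊥-elim (i≢i refl)

  δ-other : ∀ i l → l ≢ i → δ i l ≡ ℤ.+ 0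
  δ-other i l l≢i with l FinP.≟ i
  ... | yes l≡i = ⊥-elim (l≢i l≡i)
  ... | no  _   = refl

  +1≢+0 : ℤ.+ 1 ≢ ℤ.+ 0
  +1≢+0 ()

  sum-δ : ∀ i (x : Fin m → ℤ) → sumℤ (λ l → δ i l ℤ.* x l) ≡ x i
  sum-δ i x = trans (Σℤ.sum-single (allFin m) (UniqueP.allFin⁺ m) (∈P.∈-allFin i) (λ l _ l≢i → cong (ℤ._* x l) (δ-other i l l≢i)))
                    (trans (cong (ℤ._* x i) (δ-same i)) (ℤP.*-identityˡ (x i)))

  combination-support : Independent P → ∀ Q (c : Fin m → ℤ) i → c i ≢ ℤ.+ 0 →
                        (∀ α → sumℤ (λ l → c l ℤ.* coeff (P l) α) ≡ coeff Q α) → ∃ λ α → α ∈ Support.support Q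
  combination-support indep Q c i cᵢ≢0 Σ≡Q with Support.support Q in support≡
  ... | α ∷ _ = α , here refl
  ... | []    = ⊥-elim (cᵢ≢0 (indep c (λ α _ → trans (Σ≡Q α) (coeff≡0 α)) i))
    where
    coeff≡0 : ∀ α → coeff Q α ≡ ℤ.+ 0
    coeff≡0 α with coeff Q α ℤ.≟ ℤ.+ 0
    ... | yes cα≡0 = cα≡0
    ... | no  cα≢0 with () ← subst (α ∈_) support≡ (Support.coeff≢0⇒∈support Q cα≢0)

  family-support : Independent P → ∀ {Q} → Q ∈ family → ∃ λ α → α ∈ Support.support Q
  family-support indep Q∈ with ∈P.∈-++⁻ (map P (allFin m)) Q∈
  ... | inj₁ Q∈P with ∈P.∈-map⁻ P Q∈P
  ...   | i , _ , refl = combination-support indep (P i) (δ i) i (+1≢+0 ∘ trans (sym (δ-same i))) (λ α → sum-δ i _)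
  family-support indep Q∈ | inj₂ Q∈D with Any.satisfied (∈P.∈-concatMap⁻ (λ i → map (difference i) (others i)) {xs = allFin m} Q∈D)
  ... | i , Q∈Dᵢ with ∈P.∈-map⁻ (difference i) Q∈Dᵢ
  ...   | j , j∈ , refl = combination-support indep (difference i j) (λ l → δ i l ℤ.- δ j l) i δᵢᵢ-δⱼᵢ≢0 Σ≡D
    where
    i≢j : i ≢ j
    i≢j = proj₂ (∈P.∈-filter⁻ (λ j → ¬? (i FinP.≟ j)) {xs = allFin m} j∈)
    δᵢᵢ-δⱼᵢ≢0 : δ i i ℤ.- δ j i ≢ ℤ.+ 0
    δᵢᵢ-δⱼᵢ≢0 = +1≢+0 ∘ trans (sym (cong₂ ℤ._-_ (δ-same i) (δ-other j i i≢j)))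
    Σ≡D : ∀ α → sumℤ (λ l → (δ i l ℤ.- δ j l) ℤ.* coeff (P l) α) ≡ coeff (difference i j) α
    Σ≡D α = begin
      sumℤ (λ l → (δ i l ℤ.- δ j l) ℤ.* coeff (P l) α)       ≡⟨ Σℤ.sum-cong (allFin m) (λ l _ → distrib (δ i l) (δ j l) (coeff (P l) α)) ⟩
      sumℤ (λ l → cᵢ l ℤ.+ ℤ.- cⱼ l)                          ≡⟨ Σℤ.sum-∙ (allFin m) cᵢ (ℤ.-_ ∘ cⱼ) ⟩
      sumℤ cᵢ ℤ.+ sumℤ (ℤ.-_ ∘ cⱼ)                            ≡⟨ cong (λ z → sumℤ cᵢ ℤ.+ z) (Σℤ.sum-homo ℤ.-_ refl ℤP.neg-distrib-+ (allFin m) cⱼ) ⟩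
      sumℤ cᵢ ℤ.- sumℤ cⱼ                                     ≡⟨ cong₂ ℤ._-_ (sum-δ i (λ l → coeff (P l) α)) (sum-δ j (λ l → coeff (P l) α)) ⟩
      coeff (P i) α ℤ.- coeff (P j) α                         ≡⟨ sym (cong (λ z → coeff (P i) α ℤ.+ z) (coeff-negate (P j) α)) ⟩
      coeff (P i) α ℤ.+ coeff (negate (P j)) α                ≡⟨ sym (coeff-++ (P i) (negate (P j)) α) ⟩
      coeff (difference i j) α                                ∎
      where
      open ≡-Reasoning
      cᵢ cⱼ : Fin m → ℤ
      cᵢ l = δ i l ℤ.* coeff (P l) α
      cⱼ l = δ j l ℤ.* coeff (P l) α
      distrib : ∀ a b x → (a ℤ.- b) ℤ.* x ≡ a ℤ.* x ℤ.+ ℤ.- (b ℤ.* x)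
      distrib = ℤsolve-∀

deduplicate-Unique : ∀ {a} {A : Set a} (_≟_ : (x y : A) → Dec (x ≡ y)) {xs} → Unique xs → deduplicate _≟_ xs ≡ xs
deduplicate-Unique _≟_ {[]}     []          = refl
deduplicate-Unique _≟_ {x ∷ xs} (x∉xs ∷ xs!) =
  cong (x ∷_) (trans (cong (filter (λ y → ¬? (x ≟ y))) (deduplicate-Unique _≟_ xs!)) (ListP.filter-all (λ y → ¬? (x ≟ y)) x∉xs))

<ᵇ-irrefl : ∀ n → (n <ᵇ n) ≡ false
<ᵇ-irrefl zero    = refl
<ᵇ-irrefl (suc n) = <ᵇ-irrefl n

module Vanishing {k : ℕ} (R : FinCommRing k) {n m : ℕ} (P : Fin m → Poly n) where
  open RingFacts R
  open Family P

  eval-++ : ∀ (A B : Poly n) y → eval R (A ++ B) y ≡ eval R A y + eval R B y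
  eval-++ []            B y = sym (+-identityˡ _)
  eval-++ ((β , c) ∷ A) B y = trans (cong (intCast R c * monomial R β y +_) (eval-++ A B y)) (sym (+-assoc _ _ _))

  eval-negate : ∀ (A : Poly n) y → eval R (negate A) y ≡ - eval R A y
  eval-negate []            y = sym -0#≡0#
  eval-negate ((β , c) ∷ A) y = trans (cong₂ _+_ negated-term (eval-negate A y)) (-‿+-comm _ _)
    where
    negated-term : intCast R (ℤ.- c) * monomial R β y ≡ - (intCast R c * monomial R β y)
    negated-term = trans (cong (_* monomial R β y) (intCast-neg c)) (sym (-‿distribˡ-* _ _))

  eval-difference : ∀ i j y → eval R (difference i j) y ≡ eval R (P i) y - eval R (P j) y
  eval-difference i j y = trans (eval-++ (P i) (negate (P j)) y) (cong (eval R (P i) y +_) (eval-negate (P j) y))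

  vanishing : Vec (Fin k) n → ℕ
  vanishing y = Σℕ.sum family (λ Q → Σℕ.indicator (eval R Q y FinP.≟ 0#))

  nonvanishing : ∀ {y Q} → vanishing y ≡ 0 → Q ∈ family → eval R Q y ≢ 0#
  nonvanishing {y} {Q} none Q∈ Qy≡0 with eval R Q y FinP.≟ 0# | Σℕ.sum≡0⇒ family (λ Q → Σℕ.indicator (eval R Q y FinP.≟ 0#)) none Q∈
  ... | yes _    | ()
  ... | no Qy≢0 | _ = Qy≢0 Qy≡0

  values-distinct : ∀ {y} → vanishing y ≡ 0 → Unique (0# ∷ map (λ i → eval R (P i) y) (allFin m))
  values-distinct {y} none = All.tabulate 0≢value ∷ UniqueP.map⁺ injective (UniqueP.allFin⁺ m)
    where
    0≢value : ∀ {v} → v ∈ map (λ i → eval R (P i) y) (allFin m) → 0# ≢ v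
    0≢value v∈ 0≡v with ∈P.∈-map⁻ (λ i → eval R (P i) y) v∈
    ... | i , _ , v≡Pᵢy = nonvanishing none (P∈family i) (trans (sym v≡Pᵢy) (sym 0≡v))
    injective : ∀ {i j} → eval R (P i) y ≡ eval R (P j) y → i ≡ j
    injective {i} {j} Pᵢy≡Pⱼy with i FinP.≟ j
    ... | yes i≡j = i≡j
    ... | no  i≢j = ⊥-elim (nonvanishing none (difference∈family i≢j)
                      (trans (eval-difference i j y) (trans (cong (λ z → eval R (P i) y - z) (sym Pᵢy≡Pⱼy)) (-‿inverseʳ _))))

  good≡false : ∀ A x y → Unique (0# ∷ map (λ i → eval R (P i) y) (allFin m)) → good R P A x y ≡ false
  good≡false A x y distinct = begin
    memb R x (A Fin.zero) ∧ inA ∧ (length values <ᵇ suc m) ≡⟨ cong (λ l → memb R x (A Fin.zero) ∧ inA ∧ (l <ᵇ suc m)) length-values ⟩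
    memb R x (A Fin.zero) ∧ inA ∧ (suc m <ᵇ suc m)        ≡⟨ cong (λ b → memb R x (A Fin.zero) ∧ inA ∧ b) (<ᵇ-irrefl (suc m)) ⟩
    memb R x (A Fin.zero) ∧ inA ∧ false                   ≡⟨ cong (memb R x (A Fin.zero) ∧_) (BoolP.∧-zeroʳ inA) ⟩
    memb R x (A Fin.zero) ∧ false                         ≡⟨ BoolP.∧-zeroʳ _ ⟩
    false                                                 ∎
    where
    open ≡-Reasoning
    inA = foldr _∧_ true (map (λ i → memb R (x + eval R (P i) y) (A (Fin.suc i))) (allFin m))
    values = deduplicate FinP._≟_ (0# ∷ map (λ i → eval R (P i) y) (allFin m))
    length-values : length values ≡ suc m
    length-values = trans (cong length (deduplicate-Unique FinP._≟_ distinct))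
                          (cong suc (trans (ListP.length-map _ (allFin m)) (ListP.length-tabulate id)))

  good≤vanishing : ∀ A x y → (if good R P A x y then 1 else 0) ≤ vanishing y
  good≤vanishing A x y with vanishing y ℕ.≟ 0
  ... | yes none rewrite good≡false A x y (values-distinct none) = z≤n
  ... | no  some with good R P A x y
  ...   | true  = ℕP.n≢0⇒n>0 some
  ...   | false = z≤n

square-bound : ∀ {X p M K} → 0 < p → p ℕ.* X ≤ M ℕ.* K → K ℕ.* K ≤ p → X ℕ.* X ℕ.* p ≤ M ℕ.* M
square-bound {X} {p@(suc _)} {M} {K} _ pX≤MK K²≤p = ℕP.*-cancelʳ-≤ (X ℕ.* X ℕ.* p) (M ℕ.* M) p (begin
  X ℕ.* X ℕ.* p ℕ.* p          ≡⟨ regroup₁ X p ⟩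
  (p ℕ.* X) ℕ.* (p ℕ.* X)      ≤⟨ ℕP.*-mono-≤ pX≤MK pX≤MK ⟩
  (M ℕ.* K) ℕ.* (M ℕ.* K)      ≡⟨ regroup₂ M K ⟩
  (M ℕ.* M) ℕ.* (K ℕ.* K)      ≤⟨ ℕP.*-monoʳ-≤ (M ℕ.* M) K²≤p ⟩
  M ℕ.* M ℕ.* p                ∎)
  where
  open ℕP.≤-Reasoning
  regroup₁ : ∀ X p → X ℕ.* X ℕ.* p ℕ.* p ≡ (p ℕ.* X) ℕ.* (p ℕ.* X)
  regroup₁ = solve-∀
  regroup₂ : ∀ M K → (M ℕ.* K) ℕ.* (M ℕ.* K) ≡ (M ℕ.* M) ℕ.* (K ℕ.* K)
  regroup₂ = solve-∀

module Bound {n m : ℕ} (P : Fin m → Poly n) (indep : Independent P) where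
  open Family P

  totalDegree : ℕ
  totalDegree = Σℕ.sum family Support.degree

  threshold : ℕ
  threshold = totalDegree ℕ.* totalDegree ℕ.+ Σℕ.sum family Support.height

  module _ {k : ℕ} (R : FinCommRing k) {N p : ℕ} (char : IsCharacteristic R N) (lpf : IsLpf p N) (threshold<p : threshold < p) where
    open RingFacts R
    open Counting R
    open SmallUnits R char lpf
    open Vanishing R P

    coefficient-unit : ∀ {Q β} → Q ∈ family → β ∈ Support.support Q → Unit (intCast R (coeff Q β))
    coefficient-unit {Q} {β} Q∈ β∈ = intCast-unit (proj₂ (Support.∈support⇒ Q β∈)) (ℕP.≤-<-trans ∣coeff∣≤threshold threshold<p)
      where
      ∣coeff∣≤threshold : ℤ.∣ coeff Q β ∣ ≤ threshold
      ∣coeff∣≤threshold = ℕP.≤-trans (Support.∣coeff∣≤height Q β∈)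
                            (ℕP.≤-trans (Σℕ.≤-sum family Support.height Q∈) (ℕP.m≤n+m _ (totalDegree ℕ.* totalDegree)))

    p*zeros≤ : ∀ {Q} → Q ∈ family → p ℕ.* zeros Q ≤ k ℕ.^ n ℕ.* Support.degree Q
    p*zeros≤ {Q} Q∈ = subst (λ l → l ℕ.* zeros Q ≤ _) (ListP.length-applyUpTo (natCast R) p)
      (zeros-bound Q (proj₂ (family-support indep Q∈)) (λ β → coefficient-unit Q∈)
                   (applyUpTo (natCast R) p) (AllPairsP.applyUpTo⁺₁ (natCast R) p natCast-apart))

    p*vanishing≤ : p ℕ.* Σℕ.sum (allVecs R n) vanishing ≤ k ℕ.^ n ℕ.* totalDegree
    p*vanishing≤ = begin
      p ℕ.* Σℕ.sum (allVecs R n) vanishing                ≡⟨ cong (p ℕ.*_) (Σℕ.sum-swap (allVecs R n) family _) ⟩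
      p ℕ.* Σℕ.sum family zeros                           ≡⟨ sym (Σℕ.sum-*ˡ p family zeros) ⟩
      Σℕ.sum family (λ Q → p ℕ.* zeros Q)                 ≤⟨ Σℕ.sum-mono family (λ Q → p*zeros≤) ⟩
      Σℕ.sum family (λ Q → k ℕ.^ n ℕ.* Support.degree Q)  ≡⟨ Σℕ.sum-*ˡ (k ℕ.^ n) family Support.degree ⟩
      k ℕ.^ n ℕ.* totalDegree                             ∎
      where open ℕP.≤-Reasoning

    count≤ : ∀ A → count R P A ≤ k ℕ.* Σℕ.sum (allVecs R n) vanishing
    count≤ A = begin
      count R P A                                               ≡⟨ cong (foldr ℕ._+_ 0) (sym (ListP.map-id table)) ⟩
      Σℕ.sum table id
        ≡⟨ Σℕ.sum-concatMap _ (allFin k) id ⟩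
      Σℕ.sum (allFin k) (λ x → Σℕ.sum (map (indicator x) (allVecs R n)) id)
        ≡⟨ Σℕ.sum-cong (allFin k) (λ x _ → Σℕ.sum-map (indicator x) (allVecs R n) id) ⟩
      Σℕ.sum (allFin k) (λ x → Σℕ.sum (allVecs R n) (indicator x))
        ≤⟨ Σℕ.sum-mono (allFin k) (λ x _ → Σℕ.sum-mono (allVecs R n) (λ y _ → good≤vanishing A x y)) ⟩
      Σℕ.sum (allFin k) (λ _ → Σℕ.sum (allVecs R n) vanishing)  ≡⟨ Σℕ.sum-const (allFin k) _ ⟩
      length (allFin k) ℕ.* Σℕ.sum (allVecs R n) vanishing      ≡⟨ cong (ℕ._* Σℕ.sum (allVecs R n) vanishing) length-allFin ⟩
      k ℕ.* Σℕ.sum (allVecs R n) vanishing                      ∎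
      where
      open ℕP.≤-Reasoning
      indicator : Fin k → Vec (Fin k) n → ℕ
      indicator x y = if good R P A x y then 1 else 0
      table : List ℕ
      table = concatMap (λ x → map (indicator x) (allVecs R n)) (allFin k)

    p*count≤ : ∀ A → p ℕ.* count R P A ≤ k ℕ.^ suc n ℕ.* totalDegree
    p*count≤ A = begin
      p ℕ.* count R P A                                   ≤⟨ ℕP.*-monoʳ-≤ p (count≤ A) ⟩
      p ℕ.* (k ℕ.* Σℕ.sum (allVecs R n) vanishing)        ≡⟨ x∙yz≈y∙xz p k _ ⟩
      k ℕ.* (p ℕ.* Σℕ.sum (allVecs R n) vanishing)        ≤⟨ ℕP.*-monoʳ-≤ k p*vanishing≤ ⟩
      k ℕ.* (k ℕ.^ n ℕ.* totalDegree)                     ≡⟨ sym (ℕP.*-assoc k (k ℕ.^ n) totalDegree) ⟩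
      k ℕ.^ suc n ℕ.* totalDegree                         ∎
      where
      open ℕP.≤-Reasoning
      open Algebra.Properties.CommutativeSemigroup ℕP.*-commutativeSemigroup using (x∙yz≈y∙xz)

    count²*p≤ : ∀ A → count R P A ℕ.* count R P A ℕ.* p ≤ k ℕ.^ suc n ℕ.* k ℕ.^ suc n
    count²*p≤ A = square-bound {M = k ℕ.^ suc n} {K = totalDegree} (ℕP.≤-<-trans z≤n threshold<p) (p*count≤ A)
                               (ℕP.≤-trans (ℕP.m≤m+n _ _) (ℕP.<⇒≤ threshold<p))

open import Data.Nat using (_*_; _^_)

proposition6p1 : ∀ (n m : ℕ) (P : Fin m → Poly n) → Independent P →
    Σ ℕ λ C → Σ ℕ λ a → Σ ℕ λ b → 0 < a × 0 < b ×
      (∀ (k : ℕ) (R : FinCommRing k) (N : ℕ) → IsCharacteristic R N →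
        ∀ (p : ℕ) → IsLpf p N → C < p →
        ∀ (A : Fin (suc m) → Subset k) →
        count R P A ^ b * p ^ a ≤ k ^ (suc n * b))
proposition6p1 n m P indep = threshold , 1 , 2 , s≤s z≤n , s≤s z≤n , λ k R N char p lpf threshold<p A →
  subst₂ _≤_ (exponents (count R P A) p) (trans (square (k ^ suc n)) (ℕP.^-*-assoc k (suc n) 2))
             (count²*p≤ R char lpf threshold<p A)
  where
  open Bound P indep
  exponents : ∀ X q → X * X * q ≡ X ^ 2 * q ^ 1
  exponents X q = cong₂ _*_ (cong (X *_) (sym (ℕP.*-identityʳ X))) (sym (ℕP.*-identityʳ q))
  square : ∀ M → M * M ≡ M ^ 2
  square M = cong (M *_) (sym (ℕP.*-identityʳ M))
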